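{- For $n\ge1$ let $\beta_{\mathrm{rainbow}}\in\mathcal S_n$ be the permutation $(1,n)(2,n-1)\cdots(\tfrac n2,\tfrac n2+1)$ if $n$ is even and $(1,n)(2,n-1)\cdots(\tfrac{n-1}2,\tfrac{n+3}2)(\tfrac{n+1}2)$ if $n$ is odd. Then, as formal power series, $$M(X,Y,A):=\sum_{n=1}^\infty X^n\sum_{\alpha\in\mathrm{Int}(n)}Y^{\|\alpha^{ -1}\beta_{\mathrm{rainbow}}\|}A^{\|\alpha\|}=\frac{X+X^2(Y+A)}{1-X^2Y(1+2YA+A^2)}.$$
   Context: $\mathcal S_n$ is the symmetric group on $[n]$; $\#\alpha$ denotes the number of cycles of $\alpha\in\mathcal S_n$ and $\|\alpha\|=n-\#\alpha$. $\mathrm{Int}(n)$ is the set of interval partitions of $[n]$ (every block consists of consecutive integers), each identified with the permutation whose cycles are its blocks with elements listed in increasing order. -}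

module Defs where

open import Data.Nat using (ℕ; zero; suc; _+_; _∸_; _<ᵇ_; _≤ᵇ_; _≡ᵇ_)
open import Data.Bool using (Bool; true; false; if_then_else_; _∧_)
open import Data.List using (List; []; _∷_; map; _++_; length; filter; upTo; foldr)
open import Data.Integer as ℤ using (ℤ; +_; -_)
import Data.Integer as Z
open import Relation.Nullary.Decidable using (does)
open import Data.Bool.Properties using (T?)
open import Data.Bool using (T)

-- Permutations of [n] are encoded 0-indexed: a permutation of {0,…,n-1}
-- is a function ℕ → ℕ (only its values on 0,…,n-1 matter).

iter : ℕ → (ℕ → ℕ) → ℕ → ℕ
iter zero    σ i = i
iter (suc k) σ i = σ (iter k σ i)

-- i is the minimum of its cycle under σ (orbit has size ≤ n)
isCycleMin : ℕ → (ℕ → ℕ) → ℕ → Bool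
isCycleMin n σ i = foldr (λ k r → (i ≤ᵇ iter k σ i) ∧ r) true (upTo n)

numCycles : ℕ → (ℕ → ℕ) → ℕ
numCycles n σ = length (filter (λ i → T? (isCycleMin n σ i)) (upTo n))

norm : ℕ → (ℕ → ℕ) → ℕ
norm n σ = n ∸ numCycles n σ

inv : ℕ → (ℕ → ℕ) → ℕ → ℕ
inv n σ i = foldr (λ j r → if σ j ≡ᵇ i then j else r) 0 (upTo n)

_∘ₚ_ : (ℕ → ℕ) → (ℕ → ℕ) → ℕ → ℕ
(f ∘ₚ g) i = f (g i)

-- β_rainbow ∈ S_n : i ↦ n+1-i in 1-indexed terms, i.e. i ↦ n-1-i 0-indexed.
-- (For odd n this fixes the middle point (n+1)/2, as in the paper.)
rainbow : ℕ → ℕ → ℕ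
rainbow n i = (n ∸ 1) ∸ i

-- Interval partitions of [n] ↔ compositions of n (block sizes, left to right).

incHead : List ℕ → List ℕ
incHead []       = []
incHead (k ∷ ks) = suc k ∷ ks

-- all compositions of suc m (each exactly once)
comps⁺ : ℕ → List (List ℕ)
comps⁺ zero    = (1 ∷ []) ∷ []
comps⁺ (suc m) = map (1 ∷_) (comps⁺ m) ++ map incHead (comps⁺ m)

-- Int(n) as list of compositions of n  (n ≥ 1; Int(0) unused)
Int : ℕ → List (List ℕ)
Int zero    = []
Int (suc m) = comps⁺ m

-- the permutation whose cycles are the blocks (increasing order),
-- blocks starting at offset s:  i ↦ i+1 inside a block, last ↦ first.
blockPerm : List ℕ → ℕ → ℕ → ℕ
blockPerm []       s i = i
blockPerm (k ∷ ks) s i =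
  if i <ᵇ s + k
  then (if suc i <ᵇ s + k then suc i else s)
  else blockPerm ks (s + k) i

intPerm : List ℕ → ℕ → ℕ
intPerm c = blockPerm c 0

-- Formal power series in X, Y, A with integer coefficients:
-- F n i j = coefficient of X^n Y^i A^j.

Series : Set
Series = ℕ → ℕ → ℕ → ℤ

Σ≤ : ℕ → (ℕ → ℤ) → ℤ
Σ≤ n f = foldr (λ a r → f a Z.+ r) (+ 0) (upTo (suc n))

_⋆_ : Series → Series → Series
(F ⋆ G) n i j =
  Σ≤ n λ a → Σ≤ i λ b → Σ≤ j λ c →
    F a b c Z.* G (n ∸ a) (i ∸ b) (j ∸ c)

M : Series
M n i j = + length (filter (λ c → T? (
              (norm n (inv n (intPerm c) ∘ₚ rainbow n) ≡ᵇ i)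
            ∧ (norm n (intPerm c) ≡ᵇ j))) (Int n))

Num : Series
Num 1 0 0 = + 1
Num 2 1 0 = + 1
Num 2 0 1 = + 1
Num _ _ _ = + 0

-- denominator  1 - X²Y(1 + 2YA + A²) = 1 - X²Y - 2X²Y²A - X²YA²
Den : Series
Den 0 0 0 = + 1
Den 2 1 0 = - + 1
Den 2 2 1 = - + 2
Den 2 1 2 = - + 1
Den _ _ _ = + 0

module Submission where

-- Identify an interval partition α of [n] with its composition c of n (the block sizes) and let
-- σ_c = α⁻¹ β_rainbow.  For n ≥ 1 every composition of n + 2 arises from exactly one composition
-- c of n by one of four moves: at each end, either add a new singleton block or grow the end
-- block by one.  Deleting a point x from the cycles of a permutation keeps the number of cycles,
-- unless x is a fixed point, when it drops by one.  Deleting the two points added by a move turns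
-- σ of the new composition into σ_c, passing through exactly one fixed point for the two
-- symmetric moves and none for the two mixed ones.  Hence the four moves raise (‖α⁻¹β‖, ‖α‖) by
-- (1, 0), (1, 2), (2, 1), (2, 1), so M_{n+2} = X²Y (1 + 2YA + A²) M_n, and with M_1 = X,
-- M_2 = X² (Y + A) this is the claimed identity.

open import Defs
open import Data.Nat using (ℕ)
open import Relation.Binary.PropositionalEquality using (_≡_; trans)

module CycleCounting where

  open import Data.Nat
  open import Data.Nat.Properties
  open import Data.Nat.DivMod using (_%_; _/_; m≡m%n+[m/n]*n; m%n<n)
  open import Data.Nat.Tactic.RingSolver using (solve-∀)
  open import Algebra.Properties.CommutativeSemigroup +-commutativeSemigroup using (x∙yz≈y∙xz)
  open import Data.Bool using (Bool; true; false; T; _∧_)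
  open import Data.Bool.Properties using (T?; T-≡)
  open import Data.Bool.ListAction using (all; and)
  open import Data.Empty using (⊥-elim)
  open import Data.Fin using (toℕ; fromℕ<)
  open import Data.Fin.Properties using (pigeonhole; toℕ-fromℕ<; toℕ<n)
  open import Data.List using (List; []; _∷_; _∷ʳ_; length; filter; upTo; map)
  open import Data.List.Properties using (upTo-∷ʳ; foldr-map; map-cong)
  open import Data.List.Extrema.Nat using (min; argmin-all; min≤xs)
  open import Data.List.Membership.Propositional using (_∈_)
  open import Data.List.Membership.Propositional.Properties using (∈-upTo⁺; ∈-map⁺; ∈-map⁻; ∈-filter⁺; ∈-filter⁻)
  import Data.List.Relation.Unary.All as All
  open import Data.List.Relation.Unary.All.Properties using (all⁺; all⁻)
  open import Data.Product using (∃; _×_; _,_; proj₁; proj₂)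
  open import Data.Sum using (_⊎_; inj₁; inj₂)
  open import Function using (_∘_)
  open import Function.Bundles using (_⇔_; mk⇔; Equivalence)
  import Function.Properties.Equivalence as ⇔
  open import Relation.Nullary using (¬_; yes; no; ¬?)
  open import Relation.Binary.Definitions using (tri<; tri≈; tri>)
  open import Relation.Binary.PropositionalEquality

  T-⇔⇒≡ : ∀ {a b} → (T a ⇔ T b) → a ≡ b
  T-⇔⇒≡ {false} {false} _ = refl
  T-⇔⇒≡ {false} {true}  e = ⊥-elim (Equivalence.from e _)
  T-⇔⇒≡ {true}  {false} e = ⊥-elim (Equivalence.to e _)
  T-⇔⇒≡ {true}  {true}  _ = refl

  <ᵇ-true : ∀ {m n} → m < n → (m <ᵇ n) ≡ true
  <ᵇ-true = Equivalence.to T-≡ ∘ <⇒<ᵇ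

  <ᵇ-false : ∀ {m n} → n ≤ m → (m <ᵇ n) ≡ false
  <ᵇ-false {m} {n} n≤m with m <ᵇ n in eq
  ... | true  = ⊥-elim (<⇒≱ (<ᵇ⇒< m n (subst T (sym eq) _)) n≤m)
  ... | false = refl

  <ᵇ-true⇒< : ∀ {m n} → (m <ᵇ n) ≡ true → m < n
  <ᵇ-true⇒< {m} {n} eq = <ᵇ⇒< m n (Equivalence.from T-≡ eq)

  <ᵇ-false⇒≥ : ∀ {m n} → (m <ᵇ n) ≡ false → n ≤ m
  <ᵇ-false⇒≥ eq = ≮⇒≥ (λ m<n → subst T eq (<⇒<ᵇ m<n))

  ≤ᵇ-true : ∀ {m n} → m ≤ n → (m ≤ᵇ n) ≡ true
  ≤ᵇ-true = Equivalence.to T-≡ ∘ ≤⇒≤ᵇ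

  ≤ᵇ-false : ∀ {m n} → ¬ m ≤ n → (m ≤ᵇ n) ≡ false
  ≤ᵇ-false {m} {n} m≰n with m ≤ᵇ n in eq
  ... | true  = ⊥-elim (m≰n (≤ᵇ⇒≤ m n (subst T (sym eq) _)))
  ... | false = refl

  ≡ᵇ-refl : ∀ m → (m ≡ᵇ m) ≡ true
  ≡ᵇ-refl m = Equivalence.to T-≡ (≡⇒≡ᵇ m m refl)

  ≡ᵇ-false : ∀ {m n} → m ≢ n → (m ≡ᵇ n) ≡ false
  ≡ᵇ-false {m} {n} m≢n with m ≡ᵇ n in eq
  ... | true  = ⊥-elim (m≢n (≡ᵇ⇒≡ m n (subst T (sym eq) _)))
  ... | false = refl

  ≡ᵇ-false⇒≢ : ∀ {m n} → (m ≡ᵇ n) ≡ false → m ≢ n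
  ≡ᵇ-false⇒≢ {m} {n} eq m≡n = subst T eq (≡⇒≡ᵇ m n m≡n)

  indicator : Bool → ℕ
  indicator true  = 1
  indicator false = 0

  count : (ℕ → Bool) → ℕ → ℕ
  count f zero    = 0
  count f (suc n) = count f n + indicator (f n)

  length-filter-∷ʳ : ∀ (f : ℕ → Bool) xs y →
    length (filter (T? ∘ f) (xs ∷ʳ y)) ≡ length (filter (T? ∘ f) xs) + indicator (f y)
  length-filter-∷ʳ f [] y with f y
  ... | true  = refl
  ... | false = refl
  length-filter-∷ʳ f (x ∷ xs) y with f x
  ... | true  = cong suc (length-filter-∷ʳ f xs y)
  ... | false = length-filter-∷ʳ f xs y

  length-filter-upTo : ∀ (f : ℕ → Bool) n → length (filter (T? ∘ f) (upTo n)) ≡ count f n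
  length-filter-upTo f zero    = refl
  length-filter-upTo f (suc n) = begin
    length (filter (T? ∘ f) (upTo (suc n)))              ≡⟨ cong (length ∘ filter (T? ∘ f)) (upTo-∷ʳ n) ⟨
    length (filter (T? ∘ f) (upTo n ∷ʳ n))               ≡⟨ length-filter-∷ʳ f (upTo n) n ⟩
    length (filter (T? ∘ f) (upTo n)) + indicator (f n)  ≡⟨ cong (_+ indicator (f n)) (length-filter-upTo f n) ⟩
    count f n + indicator (f n)                          ∎
    where open ≡-Reasoning

  count-cong : ∀ {f g} n → (∀ {i} → i < n → f i ≡ g i) → count f n ≡ count g n
  count-cong zero    _  = refl
  count-cong (suc n) eq = cong₂ _+_ (count-cong n (eq ∘ m<n⇒m<1+n)) (cong indicator (eq ≤-refl))

  count≤ : ∀ f n → count f n ≤ n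
  count≤ f zero    = z≤n
  count≤ f (suc n) = ≤-trans (+-mono-≤ (count≤ f n) (indicator≤1 (f n))) (≤-reflexive (+-comm n 1))
    where
    indicator≤1 : ∀ b → indicator b ≤ 1
    indicator≤1 true  = ≤-refl
    indicator≤1 false = z≤n

  punchIn : ℕ → ℕ → ℕ
  punchIn x i with i <? x
  ... | yes _ = i
  ... | no  _ = suc i

  punchOut : ℕ → ℕ → ℕ
  punchOut x j with j <? x
  ... | yes _ = j
  ... | no  _ = pred j

  punchIn-< : ∀ {x i} → i < x → punchIn x i ≡ i
  punchIn-< {x} {i} i<x with i <? x
  ... | yes _   = refl
  ... | no  i≮x = ⊥-elim (i≮x i<x)

  punchIn-≥ : ∀ {x i} → x ≤ i → punchIn x i ≡ suc i
  punchIn-≥ {x} {i} x≤i with i <? x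
  ... | yes i<x = ⊥-elim (<⇒≱ i<x x≤i)
  ... | no  _   = refl

  punchOut-< : ∀ {x j} → j < x → punchOut x j ≡ j
  punchOut-< {x} {j} j<x with j <? x
  ... | yes _   = refl
  ... | no  j≮x = ⊥-elim (j≮x j<x)

  punchOut-> : ∀ {x j} → x < j → punchOut x j ≡ pred j
  punchOut-> {x} {j} x<j with j <? x
  ... | yes j<x = ⊥-elim (<-asym x<j j<x)
  ... | no  _   = refl

  punchInᵢ≢i : ∀ x i → punchIn x i ≢ x
  punchInᵢ≢i x i with i <? x
  ... | yes i<x = <⇒≢ i<x
  ... | no  i≮x = λ i+1≡x → i≮x (≤-reflexive i+1≡x)

  punchIn-bounded : ∀ {N x i} → x ≤ N → i < N → punchIn x i < suc N
  punchIn-bounded {x = x} {i} _ i<N with i <? x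
  ... | yes _ = m<n⇒m<1+n i<N
  ... | no  _ = s≤s i<N

  punchOut-bounded : ∀ {N x w} → x ≤ N → w < suc N → w ≢ x → punchOut x w < N
  punchOut-bounded {x = x} {w} x≤N w<N+1 w≢x with w <? x
  ... | yes w<x = <-≤-trans w<x x≤N
  punchOut-bounded {w = suc w} _ w<N+1 _   | no _   = s≤s⁻¹ w<N+1
  punchOut-bounded {w = zero}  _ _     w≢x | no w≮x = ⊥-elim (w≮x (≤∧≢⇒< z≤n w≢x))

  punchIn-punchOut : ∀ {x w} → w ≢ x → punchIn x (punchOut x w) ≡ w
  punchIn-punchOut {x} {w} w≢x with w <? x
  ... | yes w<x = punchIn-< w<x
  punchIn-punchOut {w = suc w} w≢x | no w≮x = punchIn-≥ (s≤s⁻¹ (≤∧≢⇒< (≮⇒≥ w≮x) (w≢x ∘ sym)))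
  punchIn-punchOut {w = zero}  w≢x | no w≮x = ⊥-elim (w≮x (≤∧≢⇒< z≤n w≢x))

  punchOut-punchIn : ∀ x i → punchOut x (punchIn x i) ≡ i
  punchOut-punchIn x i with i <? x
  ... | yes i<x = punchOut-< i<x
  ... | no  i≮x = punchOut-> (s≤s (≮⇒≥ i≮x))

  punchIn-mono-≤ : ∀ x {a b} → a ≤ b → punchIn x a ≤ punchIn x b
  punchIn-mono-≤ x {a} {b} a≤b with a <? x | b <? x
  ... | yes _   | yes _   = a≤b
  ... | yes _   | no  _   = m≤n⇒m≤1+n a≤b
  ... | no  a≮x | yes b<x = ⊥-elim (a≮x (≤-<-trans a≤b b<x))
  ... | no  _   | no  _   = s≤s a≤b

  punchOut-mono-≤ : ∀ x {a b} → a ≤ b → punchOut x a ≤ punchOut x b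
  punchOut-mono-≤ x {a} {b} a≤b with a <? x | b <? x
  ... | yes _   | yes _   = a≤b
  ... | yes a<x | no  b≮x = <⇒≤pred (<-≤-trans a<x (≮⇒≥ b≮x))
  ... | no  _   | yes _   = ≤-trans pred[n]≤n a≤b
  ... | no  _   | no  _   = pred-mono-≤ a≤b

  count-punchIn : ∀ f {x n} → x ≤ n → count f (suc n) ≡ indicator (f x) + count (f ∘ punchIn x) n
  count-punchIn f {x} {n} x≤n with m≤n⇒m<n∨m≡n x≤n
  ... | inj₂ refl = begin
    count f x + indicator (f x)                ≡⟨ +-comm _ (indicator (f x)) ⟩
    indicator (f x) + count f x                ≡⟨ cong (indicator (f x) +_) (count-cong x (cong f ∘ sym ∘ punchIn-<)) ⟩
    indicator (f x) + count (f ∘ punchIn x) x  ∎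
    where open ≡-Reasoning
  count-punchIn f {x} {suc n} _ | inj₁ x<n+1 = begin
    count f (suc n) + indicator (f (suc n))
      ≡⟨ cong (_+ indicator (f (suc n))) (count-punchIn f (s≤s⁻¹ x<n+1)) ⟩
    indicator (f x) + count (f ∘ punchIn x) n + indicator (f (suc n))
      ≡⟨ +-assoc (indicator (f x)) _ _ ⟩
    indicator (f x) + (count (f ∘ punchIn x) n + indicator (f (suc n)))
      ≡⟨ cong (λ j → indicator (f x) + (count (f ∘ punchIn x) n + indicator (f j))) (punchIn-≥ (s≤s⁻¹ x<n+1)) ⟨
    indicator (f x) + count (f ∘ punchIn x) (suc n) ∎
    where open ≡-Reasoning

  count-except : ∀ {f g n a} → a < n → (∀ {j} → j < n → j ≢ a → f j ≡ g j) →
                 count f n + indicator (g a) ≡ count g n + indicator (f a)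
  count-except {f} {g} {suc n} {a} a<n f≗g = begin
    count f (suc n) + indicator (g a)                           ≡⟨ cong (_+ indicator (g a)) (count-punchIn f a≤n) ⟩
    indicator (f a) + count (f ∘ punchIn a) n + indicator (g a) ≡⟨ cong (λ c → indicator (f a) + c + indicator (g a)) agree ⟩
    indicator (f a) + count (g ∘ punchIn a) n + indicator (g a) ≡⟨ swap (indicator (f a)) _ _ ⟩
    indicator (g a) + count (g ∘ punchIn a) n + indicator (f a) ≡⟨ cong (_+ indicator (f a)) (count-punchIn g a≤n) ⟨
    count g (suc n) + indicator (f a)                           ∎
    where
    open ≡-Reasoning
    a≤n = s≤s⁻¹ a<n
    agree : count (f ∘ punchIn a) n ≡ count (g ∘ punchIn a) n
    agree = count-cong n (λ j<n → f≗g (punchIn-bounded a≤n j<n) (punchInᵢ≢i a _))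
    swap : ∀ p c q → p + c + q ≡ q + c + p
    swap = solve-∀

  iter-+ : ∀ m n σ i → iter (m + n) σ i ≡ iter m σ (iter n σ i)
  iter-+ zero    n σ i = refl
  iter-+ (suc m) n σ i = cong σ (iter-+ m n σ i)

  iter-cong : ∀ {σ τ} → σ ≗ τ → ∀ k i → iter k σ i ≡ iter k τ i
  iter-cong σ≗τ zero    i = refl
  iter-cong {σ} σ≗τ (suc k) i = trans (cong σ (iter-cong σ≗τ k i)) (σ≗τ _)

  iter-*-period : ∀ σ p i → iter p σ i ≡ i → ∀ q → iter (q * p) σ i ≡ i
  iter-*-period σ p i periodic zero    = refl
  iter-*-period σ p i periodic (suc q) = begin
    iter (p + q * p) σ i         ≡⟨ iter-+ p (q * p) σ i ⟩
    iter p σ (iter (q * p) σ i)  ≡⟨ cong (iter p σ) (iter-*-period σ p i periodic q) ⟩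
    iter p σ i                   ≡⟨ periodic ⟩
    i                            ∎
    where open ≡-Reasoning

  record Perm (N : ℕ) (σ : ℕ → ℕ) : Set where
    field
      bounded   : ∀ {i} → i < N → σ i < N
      injective : ∀ {i j} → i < N → j < N → σ i ≡ σ j → i ≡ j
  open Perm public

  perm-∘ : ∀ {N σ τ} → Perm N σ → Perm N τ → Perm N (σ ∘ τ)
  perm-∘ σ-perm τ-perm = record
    { bounded   = bounded σ-perm ∘ bounded τ-perm
    ; injective = λ i<N j<N eq → injective τ-perm i<N j<N
                    (injective σ-perm (bounded τ-perm i<N) (bounded τ-perm j<N) eq)
    }

  module _ {N σ} (σ-perm : Perm N σ) where

    iter-bounded : ∀ k {i} → i < N → iter k σ i < N
    iter-bounded zero    i<N = i<N
    iter-bounded (suc k) i<N = bounded σ-perm (iter-bounded k i<N)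

    iter-injective : ∀ k {i j} → i < N → j < N → iter k σ i ≡ iter k σ j → i ≡ j
    iter-injective zero    _   _   eq = eq
    iter-injective (suc k) i<N j<N eq =
      iter-injective k i<N j<N (injective σ-perm (iter-bounded k i<N) (iter-bounded k j<N) eq)

    period : ∀ {i} → i < N → ∃ λ p → 0 < p × p ≤ N × iter p σ i ≡ i
    period {i} i<N with pigeonhole (n<1+n N) (λ k → fromℕ< (iter-bounded (toℕ k) i<N))
    ... | a , b , a<b , same = toℕ b ∸ toℕ a , m<n⇒0<n∸m a<b , b-a≤N , back
      where
      σᵃi≡σᵇi : iter (toℕ a) σ i ≡ iter (toℕ b) σ i
      σᵃi≡σᵇi = trans (sym (toℕ-fromℕ< _)) (trans (cong toℕ same) (toℕ-fromℕ< _))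
      b-a≤N : toℕ b ∸ toℕ a ≤ N
      b-a≤N = ≤-trans (m∸n≤m (toℕ b) (toℕ a)) (s≤s⁻¹ (toℕ<n b))
      back : iter (toℕ b ∸ toℕ a) σ i ≡ i
      back = iter-injective (toℕ a) (iter-bounded (toℕ b ∸ toℕ a) i<N) i<N (begin
        iter (toℕ a) σ (iter (toℕ b ∸ toℕ a) σ i) ≡⟨ iter-+ (toℕ a) _ σ i ⟨
        iter (toℕ a + (toℕ b ∸ toℕ a)) σ i         ≡⟨ cong (λ k → iter k σ i) (m+[n∸m]≡n (<⇒≤ a<b)) ⟩
        iter (toℕ b) σ i                           ≡⟨ σᵃi≡σᵇi ⟨
        iter (toℕ a) σ i                           ∎)
        where open ≡-Reasoning

    iter-mod : ∀ {i} → i < N → ∀ K → ∃ λ r → r < N × iter K σ i ≡ iter r σ i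
    iter-mod {i} i<N K with period i<N
    ... | p@(suc _) , _ , p≤N , periodic = K % p , <-≤-trans (m%n<n K p) p≤N , (begin
      iter K σ i                               ≡⟨ cong (λ k → iter k σ i) (m≡m%n+[m/n]*n K p) ⟩
      iter (K % p + K / p * p) σ i             ≡⟨ iter-+ (K % p) _ σ i ⟩
      iter (K % p) σ (iter (K / p * p) σ i)    ≡⟨ cong (iter (K % p) σ) (iter-*-period σ p i periodic (K / p)) ⟩
      iter (K % p) σ i                         ∎)
      where open ≡-Reasoning

  Orbit : (ℕ → ℕ) → ℕ → ℕ → Set
  Orbit σ j z = ∃ λ K → iter K σ j ≡ z

  orbit-trans : ∀ {σ a b c} → Orbit σ a b → Orbit σ b c → Orbit σ a c
  orbit-trans {σ} {a} (K , refl) (L , refl) = L + K , iter-+ L K σ a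

  orbit-sym : ∀ {N σ} → Perm N σ → ∀ {j z} → j < N → Orbit σ j z → Orbit σ z j
  orbit-sym {σ = σ} σ-perm {j} j<N (a , refl) with period σ-perm j<N
  ... | p@(suc _) , _ , _ , periodic = p * a ∸ a , (begin
    iter (p * a ∸ a) σ (iter a σ j) ≡⟨ iter-+ (p * a ∸ a) a σ j ⟨
    iter (p * a ∸ a + a) σ j        ≡⟨ cong (λ k → iter k σ j) (trans (m∸n+n≡m a≤pa) (*-comm p a)) ⟩
    iter (a * p) σ j                ≡⟨ iter-*-period σ p j periodic a ⟩
    j                               ∎)
    where
    open ≡-Reasoning
    a≤pa : a ≤ p * a
    a≤pa = m≤n*m a p

  IsCycleMin : (ℕ → ℕ) → ℕ → Set
  IsCycleMin σ i = ∀ k → i ≤ iter k σ i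

  isCycleMin≡all : ∀ N σ i → isCycleMin N σ i ≡ all (λ k → i ≤ᵇ iter k σ i) (upTo N)
  isCycleMin≡all N σ i = sym (foldr-map _∧_ (λ k → i ≤ᵇ iter k σ i) true (upTo N))

  isCycleMin⇔IsCycleMin : ∀ {N σ i} → Perm N σ → i < N → T (isCycleMin N σ i) ⇔ IsCycleMin σ i
  isCycleMin⇔IsCycleMin {N} {σ} {i} σ-perm i<N = mk⇔ sound complete
    where
    p : ℕ → Bool
    p k = i ≤ᵇ iter k σ i
    sound : T (isCycleMin N σ i) → IsCycleMin σ i
    sound t K with iter-mod σ-perm i<N K
    ... | r , r<N , σᴷi≡σʳi = subst (i ≤_) (sym σᴷi≡σʳi)
      (≤ᵇ⇒≤ i _ (All.lookup (all⁺ p (upTo N) (subst T (isCycleMin≡all N σ i) t)) (∈-upTo⁺ r<N)))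
    complete : IsCycleMin σ i → T (isCycleMin N σ i)
    complete min = subst T (sym (isCycleMin≡all N σ i)) (all⁻ p {upTo N} (All.tabulate (λ {k} _ → ≤⇒≤ᵇ (min k))))

  numCycles≡count : ∀ N σ → numCycles N σ ≡ count (isCycleMin N σ) N
  numCycles≡count N σ = length-filter-upTo (isCycleMin N σ) N

  numCycles≤ : ∀ N σ → numCycles N σ ≤ N
  numCycles≤ N σ = subst (_≤ N) (sym (numCycles≡count N σ)) (count≤ _ N)

  numCycles-cong : ∀ {N σ τ} → (∀ {i} → i < N → σ i < N) → (∀ {i} → i < N → σ i ≡ τ i) →
                   numCycles N σ ≡ numCycles N τ
  numCycles-cong {N} {σ} {τ} σ-bounded σ≡τ = begin
    numCycles N σ              ≡⟨ numCycles≡count N σ ⟩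
    count (isCycleMin N σ) N   ≡⟨ count-cong N (λ {i} i<N → begin
      isCycleMin N σ i                          ≡⟨ isCycleMin≡all N σ i ⟩
      all (λ k → i ≤ᵇ iter k σ i) (upTo N)      ≡⟨ cong and (map-cong (cong (i ≤ᵇ_) ∘ proj₁ ∘ iter-agree i<N) (upTo N)) ⟩
      all (λ k → i ≤ᵇ iter k τ i) (upTo N)      ≡⟨ isCycleMin≡all N τ i ⟨
      isCycleMin N τ i                          ∎) ⟩
    count (isCycleMin N τ) N   ≡⟨ numCycles≡count N τ ⟨
    numCycles N τ              ∎
    where
    open ≡-Reasoning
    iter-agree : ∀ {i} → i < N → ∀ k → iter k σ i ≡ iter k τ i × iter k σ i < N
    iter-agree i<N zero    = refl , i<N
    iter-agree i<N (suc k) with iter-agree i<N k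
    ... | same , bound = trans (σ≡τ bound) (cong τ same) , σ-bounded bound

  IsCycleMin-cong : ∀ {σ τ} → σ ≗ τ → ∀ {j} → IsCycleMin σ j ⇔ IsCycleMin τ j
  IsCycleMin-cong σ≗τ {j} = mk⇔ (λ min k → subst (j ≤_) (iter-cong σ≗τ k j) (min k))
                                (λ min k → subst (j ≤_) (sym (iter-cong σ≗τ k j)) (min k))

  bypass : ℕ → (ℕ → ℕ) → ℕ → ℕ
  bypass x σ j with σ j ≟ x
  ... | yes _ = σ x
  ... | no  _ = σ j

  -- remove x σ: delete x from its cycle of σ on [N + 1], then renumber the other points as [N].
  remove : ℕ → (ℕ → ℕ) → ℕ → ℕ
  remove x σ i = punchOut x (bypass x σ (punchIn x i))

  bypass-≢ : ∀ {x σ w} → σ w ≢ x → bypass x σ w ≡ σ w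
  bypass-≢ {x} {σ} {w} σw≢x with σ w ≟ x
  ... | yes σw≡x = ⊥-elim (σw≢x σw≡x)
  ... | no  _    = refl

  bypass-≡ : ∀ {x σ w} → σ w ≡ x → bypass x σ w ≡ σ x
  bypass-≡ {x} {σ} {w} σw≡x with σ w ≟ x
  ... | yes _    = refl
  ... | no  σw≢x = ⊥-elim (σw≢x σw≡x)

  bypass-fixed : ∀ {x σ} → σ x ≡ x → bypass x σ ≗ σ
  bypass-fixed {x} {σ} σx≡x w with σ w ≟ x
  ... | yes σw≡x = trans σx≡x (sym σw≡x)
  ... | no  _    = refl

  bypass-moved-≢ : ∀ {x σ} → σ x ≢ x → ∀ w → bypass x σ w ≢ x
  bypass-moved-≢ {x} {σ} σx≢x w with σ w ≟ x
  ... | yes _    = σx≢x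
  ... | no  σw≢x = σw≢x

  bypass-orbit : ∀ {x σ j} k → Orbit σ j (iter k (bypass x σ) j)
  bypass-orbit zero = 0 , refl
  bypass-orbit {x} {σ} {j} (suc k) with bypass-orbit {x} {σ} {j} k
  ... | K , σᴷj≡w with σ (iter k (bypass x σ) j) ≟ x
  ...   | yes σw≡x = suc (suc K) , cong σ (trans (cong σ σᴷj≡w) σw≡x)
  ...   | no  _    = suc K , cong σ σᴷj≡w

  private
    orbit-bypass-step : ∀ x σ j K → ∃ λ k →
      iter k (bypass x σ) j ≡ iter K σ j ⊎ (iter K σ j ≡ x × σ (iter k (bypass x σ) j) ≡ x)
    orbit-bypass-step x σ j zero = 0 , inj₁ refl
    orbit-bypass-step x σ j (suc K) with orbit-bypass-step x σ j K
    ... | k , inj₂ (σᴷj≡x , σw≡x) =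
      suc k , inj₁ (trans (bypass-≡ {x} {σ} σw≡x) (cong σ (sym σᴷj≡x)))
    ... | k , inj₁ w≡σᴷj with σ (iter K σ j) ≟ x
    ...   | yes σσᴷj≡x = k , inj₂ (σσᴷj≡x , trans (cong σ w≡σᴷj) σσᴷj≡x)
    ...   | no  σσᴷj≢x = suc k , inj₁ (trans (bypass-≢ {x} {σ} (σσᴷj≢x ∘ trans (cong σ (sym w≡σᴷj)))) (cong σ w≡σᴷj))

  orbit-bypass : ∀ {x σ j z} → Orbit σ j z → z ≢ x → Orbit (bypass x σ) j z
  orbit-bypass {x} {σ} {j} (K , refl) z≢x with orbit-bypass-step x σ j K
  ... | k , inj₁ reached    = k , reached
  ... | k , inj₂ (z≡x , _)  = ⊥-elim (z≢x z≡x)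

  isCycleMin-true : ∀ {N σ j} → Perm N σ → j < N → IsCycleMin σ j → isCycleMin N σ j ≡ true
  isCycleMin-true σ-perm j<N min = T-⇔⇒≡ (mk⇔ _ (λ _ → Equivalence.from (isCycleMin⇔IsCycleMin σ-perm j<N) min))

  isCycleMin-false : ∀ {N σ j} → Perm N σ → j < N → ¬ IsCycleMin σ j → isCycleMin N σ j ≡ false
  isCycleMin-false σ-perm j<N ¬min = T-⇔⇒≡ (mk⇔ (¬min ∘ Equivalence.to (isCycleMin⇔IsCycleMin σ-perm j<N)) λ ())

  module _ {N x σ} (σ-perm : Perm (suc N) σ) (x<N : x < suc N) where

    private
      x≤N = s≤s⁻¹ x<N

    bypass≢x : ∀ {z} → z < suc N → z ≢ x → bypass x σ z ≢ x
    bypass≢x {z} z<N z≢x with σ x ≟ x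
    ... | no  σx≢x = bypass-moved-≢ {x} {σ} σx≢x z
    ... | yes σx≡x = λ eq → z≢x (injective σ-perm z<N x<N (trans (sym (bypass-fixed {x} {σ} σx≡x z)) (trans eq (sym σx≡x))))

    bypass-bounded : ∀ {z} → z < suc N → bypass x σ z < suc N
    bypass-bounded {z} z<N with σ z ≟ x
    ... | yes _ = bounded σ-perm x<N
    ... | no  _ = bounded σ-perm z<N

    bypass-injective : ∀ {z z′} → z < suc N → z′ < suc N → z ≢ x → z′ ≢ x →
                       bypass x σ z ≡ bypass x σ z′ → z ≡ z′
    bypass-injective {z} {z′} z<N z′<N z≢x z′≢x eq with σ z ≟ x | σ z′ ≟ x
    ... | yes σz≡x | yes σz′≡x = injective σ-perm z<N z′<N (trans σz≡x (sym σz′≡x))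
    ... | yes _    | no  _     = ⊥-elim (z′≢x (sym (injective σ-perm x<N z′<N eq)))
    ... | no  _    | yes _     = ⊥-elim (z≢x (injective σ-perm z<N x<N eq))
    ... | no  _    | no  _     = injective σ-perm z<N z′<N eq

    remove-perm : Perm N (remove x σ)
    remove-perm = record
      { bounded   = λ i<N → punchOut-bounded x≤N (bypass-bounded (inside i<N)) (bypass≢x (inside i<N) (punchInᵢ≢i x _))
      ; injective = λ {a} {b} a<N b<N eq → begin
          a                          ≡⟨ punchOut-punchIn x a ⟨
          punchOut x (punchIn x a)   ≡⟨ cong (punchOut x) (bypass-injective (inside a<N) (inside b<N)
                                          (punchInᵢ≢i x a) (punchInᵢ≢i x b)
                                          (punchOut-injective (bypass≢x (inside a<N) (punchInᵢ≢i x a))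
                                                              (bypass≢x (inside b<N) (punchInᵢ≢i x b)) eq)) ⟩
          punchOut x (punchIn x b)   ≡⟨ punchOut-punchIn x b ⟩
          b                          ∎
      }
      where
      open ≡-Reasoning
      inside : ∀ {i} → i < N → punchIn x i < suc N
      inside = punchIn-bounded x≤N
      punchOut-injective : ∀ {w w′} → w ≢ x → w′ ≢ x → punchOut x w ≡ punchOut x w′ → w ≡ w′
      punchOut-injective w≢x w′≢x eq = trans (sym (punchIn-punchOut w≢x)) (trans (cong (punchIn x) eq) (punchIn-punchOut w′≢x))

    iter-bypass-avoids : ∀ {j} → j < suc N → j ≢ x → ∀ k → iter k (bypass x σ) j < suc N × iter k (bypass x σ) j ≢ x
    iter-bypass-avoids j<N j≢x zero    = j<N , j≢x
    iter-bypass-avoids j<N j≢x (suc k) with iter-bypass-avoids j<N j≢x k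
    ... | w<N , w≢x = bypass-bounded w<N , bypass≢x w<N w≢x

    iter-remove : ∀ {i} → i < N → ∀ k → iter k (remove x σ) i ≡ punchOut x (iter k (bypass x σ) (punchIn x i))
    iter-remove {i} i<N zero    = sym (punchOut-punchIn x i)
    iter-remove {i} i<N (suc k) = cong (punchOut x ∘ bypass x σ) (trans (cong (punchIn x) (iter-remove i<N k))
      (punchIn-punchOut (proj₂ (iter-bypass-avoids (punchIn-bounded x≤N i<N) (punchInᵢ≢i x i) k))))

    IsCycleMin-remove⇔ : ∀ {i} → i < N → IsCycleMin (remove x σ) i ⇔ IsCycleMin (bypass x σ) (punchIn x i)
    IsCycleMin-remove⇔ {i} i<N = mk⇔
      (λ min k → subst (punchIn x i ≤_) (punchIn-punchOut (avoids k))
                   (punchIn-mono-≤ x (subst (i ≤_) (iter-remove i<N k) (min k))))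
      (λ min k → subst (_≤ iter k (remove x σ) i) (punchOut-punchIn x i)
                   (subst (punchOut x (punchIn x i) ≤_) (sym (iter-remove i<N k)) (punchOut-mono-≤ x (min k))))
      where
      avoids : ∀ k → iter k (bypass x σ) (punchIn x i) ≢ x
      avoids = proj₂ ∘ iter-bypass-avoids (punchIn-bounded x≤N i<N) (punchInᵢ≢i x i)

    isCycleMin-punchIn : ∀ {i} → i < N →
      (IsCycleMin σ (punchIn x i) ⇔ IsCycleMin (bypass x σ) (punchIn x i)) →
      isCycleMin (suc N) σ (punchIn x i) ≡ isCycleMin N (remove x σ) i
    isCycleMin-punchIn i<N σ⇔bypass = T-⇔⇒≡
      (⇔.trans (isCycleMin⇔IsCycleMin σ-perm (punchIn-bounded x≤N i<N))
      (⇔.trans σ⇔bypass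
      (⇔.trans (⇔.sym (IsCycleMin-remove⇔ i<N))
               (⇔.sym (isCycleMin⇔IsCycleMin remove-perm i<N)))))

    numCycles-remove-fixed : σ x ≡ x → numCycles (suc N) σ ≡ suc (numCycles N (remove x σ))
    numCycles-remove-fixed σx≡x = begin
      numCycles (suc N) σ                         ≡⟨ numCycles≡count (suc N) σ ⟩
      count P (suc N)                             ≡⟨ count-punchIn P x≤N ⟩
      indicator (P x) + count (P ∘ punchIn x) N   ≡⟨ cong₂ _+_ (cong indicator x-min) (count-cong N same) ⟩
      suc (count (isCycleMin N (remove x σ)) N)   ≡⟨ cong suc (numCycles≡count N (remove x σ)) ⟨
      suc (numCycles N (remove x σ))              ∎
      where
      open ≡-Reasoning
      P = isCycleMin (suc N) σ
      same : ∀ {i} → i < N → P (punchIn x i) ≡ isCycleMin N (remove x σ) i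
      same i<N = isCycleMin-punchIn i<N (IsCycleMin-cong (sym ∘ bypass-fixed σx≡x))
      iter-fixed : ∀ k → iter k σ x ≡ x
      iter-fixed zero    = refl
      iter-fixed (suc k) = trans (cong σ (iter-fixed k)) σx≡x
      x-min : P x ≡ true
      x-min = isCycleMin-true σ-perm x<N (≤-reflexive ∘ sym ∘ iter-fixed)

    module _ (σx≢x : σ x ≢ x) where

      private
        iterates candidates : List ℕ
        iterates   = map (λ k → iter k σ x) (upTo (suc N))
        candidates = filter (λ z → ¬? (z ≟ x)) iterates

        m : ℕ
        m = min (σ x) candidates

        m-orbit : Orbit σ x m × m ≢ x
        m-orbit = argmin-all (λ z → z) ((1 , refl) , σx≢x) (All.tabulate candidate)
          where
          candidate : ∀ {z} → z ∈ candidates → Orbit σ x z × z ≢ x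
          candidate z∈ with ∈-filter⁻ (λ z → ¬? (z ≟ x)) {xs = iterates} z∈
          ... | z∈map , z≢x with ∈-map⁻ (λ k → iter k σ x) {xs = upTo (suc N)} z∈map
          ...   | k , _ , refl = (k , refl) , z≢x

        m-least : ∀ {z} → Orbit σ x z → z ≢ x → m ≤ z
        m-least (K , refl) z≢x with iter-mod σ-perm x<N K
        ... | r , r<N , σᴷx≡σʳx = subst (m ≤_) (sym σᴷx≡σʳx) (All.lookup (min≤xs (σ x) candidates)
              (∈-filter⁺ (λ z → ¬? (z ≟ x)) {xs = iterates}
                (∈-map⁺ (λ k → iter k σ x) (∈-upTo⁺ r<N)) (z≢x ∘ trans σᴷx≡σʳx)))

        m≢x : m ≢ x
        m≢x = proj₂ m-orbit

        m<N : m < suc N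
        m<N = let K , σᴷx≡m = proj₁ m-orbit in subst (_< suc N) σᴷx≡m (iter-bounded σ-perm K x<N)

      IsCycleMin-bypass⇔ : ∀ {j} → j < suc N → j ≢ x → j ≢ m → IsCycleMin σ j ⇔ IsCycleMin (bypass x σ) j
      IsCycleMin-bypass⇔ {j} j<N j≢x j≢m = mk⇔
        (λ min k → let K , σᴷj≡ = bypass-orbit {x} {σ} {j} k in subst (j ≤_) σᴷj≡ (min K))
        from
        where
        from : IsCycleMin (bypass x σ) j → IsCycleMin σ j
        from min K with iter K σ j ≟ x
        ... | no  σᴷj≢x = let k , reached = orbit-bypass (K , refl) σᴷj≢x in subst (j ≤_) reached (min k)
        ... | yes σᴷj≡x = ⊥-elim (j≢m (≤-antisym j≤m (m-least (orbit-sym σ-perm j<N (K , σᴷj≡x)) j≢x)))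
          where
          j≤m : j ≤ m
          j≤m = let k , reached = orbit-bypass (orbit-trans (K , σᴷj≡x) (proj₁ m-orbit)) m≢x
                in subst (j ≤_) reached (min k)

      IsCycleMin-bypass-m : IsCycleMin (bypass x σ) m
      IsCycleMin-bypass-m k = m-least (orbit-trans (proj₁ m-orbit) (bypass-orbit k)) (avoids k)
        where
        avoids : ∀ k → iter k (bypass x σ) m ≢ x
        avoids zero    = m≢x
        avoids (suc k) = bypass-moved-≢ {x} {σ} σx≢x _

      -- Since m is least on the cycle apart from x, min(x, m) is the cycle minimum.
      x-or-m-cycleMin : indicator (isCycleMin (suc N) σ x) + indicator (isCycleMin (suc N) σ m) ≡ 1
      x-or-m-cycleMin with <-cmp x m
      ... | tri≈ _ x≡m _ = ⊥-elim (m≢x (sym x≡m))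
      ... | tri< x<m _ _ = cong₂ (λ a b → indicator a + indicator b)
        (isCycleMin-true σ-perm x<N x-min) (isCycleMin-false σ-perm m<N m-not-min)
        where
        x-min : IsCycleMin σ x
        x-min K with iter K σ x ≟ x
        ... | yes σᴷx≡x = ≤-reflexive (sym σᴷx≡x)
        ... | no  σᴷx≢x = <⇒≤ (<-≤-trans x<m (m-least (K , refl) σᴷx≢x))
        m-not-min : ¬ IsCycleMin σ m
        m-not-min min = let K , σᴷm≡x = orbit-sym σ-perm x<N (proj₁ m-orbit) in <⇒≱ x<m (subst (m ≤_) σᴷm≡x (min K))
      ... | tri> _ _ m<x = cong₂ (λ a b → indicator a + indicator b)
        (isCycleMin-false σ-perm x<N x-not-min) (isCycleMin-true σ-perm m<N m-min)
        where
        x-not-min : ¬ IsCycleMin σ x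
        x-not-min min = let K , σᴷx≡m = proj₁ m-orbit in <⇒≱ m<x (subst (x ≤_) σᴷx≡m (min K))
        m-min : IsCycleMin σ m
        m-min K with iter K σ m ≟ x
        ... | yes σᴷm≡x = subst (m ≤_) (sym σᴷm≡x) (<⇒≤ m<x)
        ... | no  σᴷm≢x = m-least (orbit-trans (proj₁ m-orbit) (K , refl)) σᴷm≢x

      numCycles-remove-moved : numCycles (suc N) σ ≡ numCycles N (remove x σ)
      numCycles-remove-moved = begin
        numCycles (suc N) σ                        ≡⟨ numCycles≡count (suc N) σ ⟩
        count P (suc N)                            ≡⟨ count-punchIn P x≤N ⟩
        indicator (P x) + count (P ∘ punchIn x) N  ≡⟨ +-cancelʳ-≡ 1 _ _ shifted ⟩
        count R N                                  ≡⟨ numCycles≡count N (remove x σ) ⟨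
        numCycles N (remove x σ)                   ∎
        where
        open ≡-Reasoning
        P = isCycleMin (suc N) σ
        R = isCycleMin N (remove x σ)
        m′ = punchOut x m
        punchIn-m′ : punchIn x m′ ≡ m
        punchIn-m′ = punchIn-punchOut m≢x
        R-m′ : R m′ ≡ true
        R-m′ = T-⇔⇒≡ (mk⇔ _ (λ _ → Equivalence.from (isCycleMin⇔IsCycleMin remove-perm m′<N)
                 (Equivalence.from (IsCycleMin-remove⇔ m′<N) (subst (IsCycleMin (bypass x σ)) (sym punchIn-m′) IsCycleMin-bypass-m))))
          where m′<N = punchOut-bounded x≤N m<N m≢x
        except : count (P ∘ punchIn x) N + 1 ≡ count R N + indicator (P m)
        except = subst₂ (λ r p → count (P ∘ punchIn x) N + indicator r ≡ count R N + indicator (P p)) R-m′ punchIn-m′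
          (count-except (punchOut-bounded x≤N m<N m≢x) λ {j} j<N j≢m′ →
            isCycleMin-punchIn j<N (IsCycleMin-bypass⇔ (punchIn-bounded x≤N j<N) (punchInᵢ≢i x j)
              (λ eq → j≢m′ (trans (sym (punchOut-punchIn x j)) (cong (punchOut x) eq)))))
        shifted : indicator (P x) + count (P ∘ punchIn x) N + 1 ≡ count R N + 1
        shifted = begin
          indicator (P x) + count (P ∘ punchIn x) N + 1     ≡⟨ +-assoc (indicator (P x)) _ 1 ⟩
          indicator (P x) + (count (P ∘ punchIn x) N + 1)   ≡⟨ cong (indicator (P x) +_) except ⟩
          indicator (P x) + (count R N + indicator (P m))   ≡⟨ x∙yz≈y∙xz (indicator (P x)) (count R N) _ ⟩
          count R N + (indicator (P x) + indicator (P m))   ≡⟨ cong (count R N +_) x-or-m-cycleMin ⟩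
          count R N + 1                                     ∎

  remove-≢ : ∀ {x σ i w} → σ (punchIn x i) ≡ w → w ≢ x → remove x σ i ≡ punchOut x w
  remove-≢ {x} {σ} {i} σ[i]≡w w≢x = cong (punchOut x) (trans (bypass-≢ {x} {σ} (w≢x ∘ trans (sym σ[i]≡w))) σ[i]≡w)

  remove-≡ : ∀ {x σ i w} → σ (punchIn x i) ≡ x → σ x ≡ w → remove x σ i ≡ punchOut x w
  remove-≡ {x} {σ} σ[i]≡x σx≡w = cong (punchOut x) (trans (bypass-≡ {x} {σ} σ[i]≡x) σx≡w)

  numCycles-remove≗ : ∀ {N x σ τ} → Perm (suc N) σ → x < suc N → (∀ {i} → i < N → remove x σ i ≡ τ i) →
                      numCycles N (remove x σ) ≡ numCycles N τ
  numCycles-remove≗ σ-perm x<N = numCycles-cong (bounded (remove-perm σ-perm x<N))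

  remove-< : ∀ {x σ i w} → σ (punchIn x i) ≡ w → w < x → remove x σ i ≡ w
  remove-< {x} {σ} {i} σ[i]≡w w<x = trans (remove-≢ {x} {σ} {i} σ[i]≡w (<⇒≢ w<x)) (punchOut-< w<x)

module IntervalPartitions where

  open CycleCounting
  open import Data.Nat
  open import Data.Nat.Properties
  open import Algebra.Properties.CommutativeSemigroup +-commutativeSemigroup using (interchange)
  open import Data.Nat.ListAction using (sum)
  open import Data.Nat.ListAction.Properties using (sum-++)
  open import Data.Bool using (Bool; true; false; T; if_then_else_; _∧_)
  open import Data.Bool.Properties using (T?; T-≡; ∧-zeroʳ)
  open import Data.Empty using (⊥-elim)
  open import Data.List using (List; []; _∷_; _++_; [_]; length; filter; map; upTo; foldr)
  open import Data.List.Properties using (++-conicalʳ; filter-++; length-++)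
  open import Data.List.Membership.Propositional using (_∈_)
  open import Data.List.Membership.Propositional.Properties using (∈-upTo⁺; ∈-upTo⁻)
  open import Data.List.Relation.Unary.Any using (here; there)
  open import Data.List.Relation.Unary.All as All using (All; []; _∷_)
  open import Data.List.Relation.Unary.All.Properties using (++⁺; ++⁻ʳ; map⁺)
  open import Data.Product using (∃₂; _×_; _,_; proj₁; proj₂)
  open import Function using (_∘_)
  open import Function.Bundles using (mk⇔; Equivalence)
  open import Relation.Nullary using (¬_; Dec; yes; no)
  open import Relation.Binary.PropositionalEquality hiding ([_])

  blockPerm⁻¹ : List ℕ → ℕ → ℕ → ℕ
  blockPerm⁻¹ []       s i = i
  blockPerm⁻¹ (k ∷ ks) s i =
    if i <ᵇ s + k
    then (if i ≡ᵇ s then pred (s + k) else pred i)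
    else blockPerm⁻¹ ks (s + k) i

  blockPerm-in : ∀ k ks s {j} → j < s + k → blockPerm (k ∷ ks) s j ≡ (if suc j <ᵇ s + k then suc j else s)
  blockPerm-in k ks s j<s+k rewrite <ᵇ-true j<s+k = refl

  blockPerm-out : ∀ k ks s {j} → s + k ≤ j → blockPerm (k ∷ ks) s j ≡ blockPerm ks (s + k) j
  blockPerm-out k ks s s+k≤j rewrite <ᵇ-false s+k≤j = refl

  blockPerm⁻¹-in : ∀ k ks s {j} → j < s + k → blockPerm⁻¹ (k ∷ ks) s j ≡ (if j ≡ᵇ s then pred (s + k) else pred j)
  blockPerm⁻¹-in k ks s j<s+k rewrite <ᵇ-true j<s+k = refl

  blockPerm⁻¹-out : ∀ k ks s {j} → s + k ≤ j → blockPerm⁻¹ (k ∷ ks) s j ≡ blockPerm⁻¹ ks (s + k) j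
  blockPerm⁻¹-out k ks s s+k≤j rewrite <ᵇ-false s+k≤j = refl

  blockPerm-suc : ∀ c s i → blockPerm c (suc s) (suc i) ≡ suc (blockPerm c s i)
  blockPerm-suc []       s i = refl
  blockPerm-suc (k ∷ ks) s i with i <ᵇ s + k
  ... | false = blockPerm-suc ks (s + k) i
  ... | true with suc i <ᵇ s + k
  ...   | true  = refl
  ...   | false = refl

  blockPerm⁻¹-suc : ∀ c s i → s ≤ i → blockPerm⁻¹ c (suc s) (suc i) ≡ suc (blockPerm⁻¹ c s i)
  blockPerm⁻¹-suc []       s i _ = refl
  blockPerm⁻¹-suc (k ∷ ks) s i s≤i with i <ᵇ s + k in lt
  ... | false = blockPerm⁻¹-suc ks (s + k) i (<ᵇ-false⇒≥ lt)
  ... | true with i ≡ᵇ s in eq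
  ...   | true  = sym (suc-pred (s + k) {{>-nonZero (≤-<-trans z≤n (<ᵇ-true⇒< lt))}})
  ...   | false = sym (suc-pred i {{>-nonZero (≤-<-trans z≤n (≤∧≢⇒< s≤i (λ s≡i → subst T eq (≡⇒≡ᵇ i s (sym s≡i)))))}})

  private
    s+k≤s+[k+t] : ∀ s k t → s + k ≤ s + (k + t)
    s+k≤s+[k+t] s k t = +-monoʳ-≤ s (m≤m+n k t)

    split-< : ∀ {i} s k t → i < s + (k + t) → i < s + k + t
    split-< {i} s k t = subst (i <_) (sym (+-assoc s k t))

    pred-< : ∀ {m n} → m < n → pred n < n
    pred-< {n = suc n} _ = ≤-refl

    suc-pred-< : ∀ {m n} → m < n → suc (pred n) ≡ n
    suc-pred-< {n = suc n} _ = refl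

    empty-block : ∀ {s i} {A : Set} → s ≤ i → i < s + 0 → A
    empty-block {s} {i} s≤i i<s+0 = ⊥-elim (<⇒≱ i<s+0 (subst (_≤ i) (sym (+-identityʳ s)) s≤i))

  blockPerm-bounded : ∀ c s {i} → s ≤ i → i < s + sum c → s ≤ blockPerm c s i × blockPerm c s i < s + sum c
  blockPerm-bounded []       s s≤i i<end = empty-block s≤i i<end
  blockPerm-bounded (k ∷ ks) s {i} s≤i i<end with i <ᵇ s + k in lt
  ... | false with blockPerm-bounded ks (s + k) (<ᵇ-false⇒≥ lt) (split-< s k _ i<end)
  ...   | lo , hi = ≤-trans (m≤m+n s k) lo , subst (blockPerm ks (s + k) i <_) (+-assoc s k (sum ks)) hi
  blockPerm-bounded (k ∷ ks) s {i} s≤i i<end | true with suc i <ᵇ s + k in lt′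
  ...   | true  = m≤n⇒m≤1+n s≤i , <-≤-trans (<ᵇ-true⇒< lt′) (s+k≤s+[k+t] s k _)
  ...   | false = ≤-refl , ≤-<-trans s≤i i<end

  blockPerm⁻¹-bounded : ∀ c s {i} → s ≤ i → i < s + sum c → s ≤ blockPerm⁻¹ c s i × blockPerm⁻¹ c s i < s + sum c
  blockPerm⁻¹-bounded []       s s≤i i<end = empty-block s≤i i<end
  blockPerm⁻¹-bounded (k ∷ ks) s {i} s≤i i<end with i <ᵇ s + k in lt
  ... | false with blockPerm⁻¹-bounded ks (s + k) (<ᵇ-false⇒≥ lt) (split-< s k _ i<end)
  ...   | lo , hi = ≤-trans (m≤m+n s k) lo , subst (blockPerm⁻¹ ks (s + k) i <_) (+-assoc s k (sum ks)) hi
  blockPerm⁻¹-bounded (k ∷ ks) s {i} s≤i i<end | true with i ≡ᵇ s in eq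
  ...   | true  = <⇒≤pred (≤-<-trans s≤i (<ᵇ-true⇒< {i} {s + k} lt)) , <-≤-trans (pred-< (<ᵇ-true⇒< {i} {s + k} lt)) (s+k≤s+[k+t] s k _)
  ...   | false = <⇒≤pred (≤∧≢⇒< s≤i (≡ᵇ-false⇒≢ eq ∘ sym)) , ≤-<-trans pred[n]≤n i<end

  blockPerm∘blockPerm⁻¹ : ∀ c s {i} → s ≤ i → i < s + sum c → blockPerm c s (blockPerm⁻¹ c s i) ≡ i
  blockPerm∘blockPerm⁻¹ []       s s≤i i<end = refl
  blockPerm∘blockPerm⁻¹ (k ∷ ks) s {i} s≤i i<end with i <ᵇ s + k in lt
  ... | false = trans (blockPerm-out k ks s (proj₁ (blockPerm⁻¹-bounded ks (s + k) s+k≤i i<end′)))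
                      (blockPerm∘blockPerm⁻¹ ks (s + k) s+k≤i i<end′)
    where
    s+k≤i = <ᵇ-false⇒≥ lt
    i<end′ = split-< s k _ i<end
  ... | true with i ≡ᵇ s in eq
  ...   | true  = begin
    blockPerm (k ∷ ks) s (pred (s + k))                     ≡⟨ blockPerm-in k ks s (pred-< i<s+k) ⟩
    (if suc (pred (s + k)) <ᵇ s + k then _ else s)          ≡⟨ cong (λ j → if j <ᵇ s + k then j else s) (suc-pred-< i<s+k) ⟩
    (if s + k <ᵇ s + k then s + k else s)                   ≡⟨ cong (if_then s + k else s) (<ᵇ-false {s + k} ≤-refl) ⟩
    s                                                       ≡⟨ ≡ᵇ⇒≡ i s (Equivalence.from T-≡ eq) ⟨
    i                                                       ∎
    where
    open ≡-Reasoning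
    i<s+k = <ᵇ-true⇒< {i} {s + k} lt
  ...   | false = begin
    blockPerm (k ∷ ks) s (pred i)                 ≡⟨ blockPerm-in k ks s (≤-<-trans pred[n]≤n (<ᵇ-true⇒< {i} {s + k} lt)) ⟩
    (if suc (pred i) <ᵇ s + k then _ else s)      ≡⟨ cong (λ j → if j <ᵇ s + k then j else s) (suc-pred-< s<i) ⟩
    (if i <ᵇ s + k then i else s)                 ≡⟨ cong (if_then i else s) lt ⟩
    i                                             ∎
    where
    open ≡-Reasoning
    s<i = ≤∧≢⇒< s≤i (≡ᵇ-false⇒≢ eq ∘ sym)

  blockPerm⁻¹∘blockPerm : ∀ c s {i} → s ≤ i → i < s + sum c → blockPerm⁻¹ c s (blockPerm c s i) ≡ i
  blockPerm⁻¹∘blockPerm []       s s≤i i<end = refl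
  blockPerm⁻¹∘blockPerm (k ∷ ks) s {i} s≤i i<end with i <ᵇ s + k in lt
  ... | false = trans (blockPerm⁻¹-out k ks s (proj₁ (blockPerm-bounded ks (s + k) s+k≤i i<end′)))
                      (blockPerm⁻¹∘blockPerm ks (s + k) s+k≤i i<end′)
    where
    s+k≤i = <ᵇ-false⇒≥ lt
    i<end′ = split-< s k _ i<end
  ... | true with suc i <ᵇ s + k in lt′
  ...   | true  = begin
    blockPerm⁻¹ (k ∷ ks) s (suc i)                        ≡⟨ blockPerm⁻¹-in k ks s (<ᵇ-true⇒< {suc i} {s + k} lt′) ⟩
    (if suc i ≡ᵇ s then pred (s + k) else i)              ≡⟨ cong (if_then pred (s + k) else i) (≡ᵇ-false (<⇒≢ (s≤s s≤i) ∘ sym)) ⟩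
    i                                                     ∎
    where open ≡-Reasoning
  ...   | false = begin
    blockPerm⁻¹ (k ∷ ks) s s                              ≡⟨ blockPerm⁻¹-in k ks s (≤-<-trans s≤i i<s+k) ⟩
    (if s ≡ᵇ s then pred (s + k) else pred s)             ≡⟨ cong (if_then pred (s + k) else pred s) (≡ᵇ-refl s) ⟩
    pred (s + k)                                          ≡⟨ ≤-antisym (pred-mono-≤ (<ᵇ-false⇒≥ {suc i} {s + k} lt′)) (<⇒≤pred i<s+k) ⟩
    i                                                     ∎
    where
    open ≡-Reasoning
    i<s+k = <ᵇ-true⇒< {i} {s + k} lt

  intPerm-perm : ∀ c → Perm (sum c) (intPerm c)
  intPerm-perm c = record
    { bounded   = proj₂ ∘ blockPerm-bounded c 0 z≤n
    ; injective = λ {i} {j} i<n j<n eq → begin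
        i                               ≡⟨ blockPerm⁻¹∘blockPerm c 0 z≤n i<n ⟨
        blockPerm⁻¹ c 0 (intPerm c i)   ≡⟨ cong (blockPerm⁻¹ c 0) eq ⟩
        blockPerm⁻¹ c 0 (intPerm c j)   ≡⟨ blockPerm⁻¹∘blockPerm c 0 z≤n j<n ⟩
        j                               ∎
    }
    where open ≡-Reasoning

  intPerm⁻¹-perm : ∀ c → Perm (sum c) (blockPerm⁻¹ c 0)
  intPerm⁻¹-perm c = record
    { bounded   = proj₂ ∘ blockPerm⁻¹-bounded c 0 z≤n
    ; injective = λ {i} {j} i<n j<n eq → begin
        i                                   ≡⟨ blockPerm∘blockPerm⁻¹ c 0 z≤n i<n ⟨
        intPerm c (blockPerm⁻¹ c 0 i)       ≡⟨ cong (intPerm c) eq ⟩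
        intPerm c (blockPerm⁻¹ c 0 j)       ≡⟨ blockPerm∘blockPerm⁻¹ c 0 z≤n j<n ⟩
        j                                   ∎
    }
    where open ≡-Reasoning

  inv-unique : ∀ {N σ i j} → Perm N σ → j < N → σ j ≡ i → inv N σ i ≡ j
  inv-unique {N} {σ} {i} {j} σ-perm j<N σj≡i = search (upTo N) ∈-upTo⁻ (∈-upTo⁺ j<N)
    where
    search : ∀ xs → (∀ {y} → y ∈ xs → y < N) → j ∈ xs → foldr (λ y r → if σ y ≡ᵇ i then y else r) 0 xs ≡ j
    search (y ∷ ys) _ (here refl) rewrite σj≡i | ≡ᵇ-refl i = refl
    search (y ∷ ys) xs<N (there j∈ys) with σ y ≡ᵇ i in eq
    ... | true  = injective σ-perm (xs<N (here refl)) j<N (trans (≡ᵇ⇒≡ _ i (Equivalence.from T-≡ eq)) (sym σj≡i))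
    ... | false = search ys (xs<N ∘ there) j∈ys

  rainbow-perm : ∀ n → Perm n (rainbow n)
  rainbow-perm n = record
    { bounded   = bounded′
    ; injective = λ i<n j<n → ∸-cancelˡ-≡ (≤pred i<n) (≤pred j<n)
    }
    where
    ≤pred : ∀ {i} → i < n → i ≤ n ∸ 1
    ≤pred {i} i<n = subst (i ≤_) (pred[n]≡n∸1 n) (<⇒≤pred i<n)
      where
      pred[n]≡n∸1 : ∀ n → pred n ≡ n ∸ 1
      pred[n]≡n∸1 zero    = refl
      pred[n]≡n∸1 (suc n) = refl
    bounded′ : ∀ {i} → i < n → rainbow n i < n
    bounded′ {i} (s≤s _) = s≤s (m∸n≤m _ i)

  α⁻¹β : ℕ → List ℕ → ℕ → ℕ
  α⁻¹β N c i = blockPerm⁻¹ c 0 (rainbow N i)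

  α⁻¹β-perm : ∀ {N} c → sum c ≡ N → Perm N (α⁻¹β N c)
  α⁻¹β-perm c refl = perm-∘ (intPerm⁻¹-perm c) (rainbow-perm (sum c))

  numCycles-α⁻¹β : ∀ c → numCycles (sum c) (inv (sum c) (intPerm c) ∘ₚ rainbow (sum c)) ≡ numCycles (sum c) (α⁻¹β (sum c) c)
  numCycles-α⁻¹β c = sym (numCycles-cong (bounded (α⁻¹β-perm c refl)) λ i<n →
    sym (inv-unique (intPerm-perm c) (bounded (α⁻¹β-perm c refl) i<n)
          (blockPerm∘blockPerm⁻¹ c 0 z≤n (bounded (rainbow-perm (sum c)) i<n))))

  Composition : List ℕ → Set
  Composition = All (0 <_)

  remove-zero-shrink : ∀ k ks i → remove 0 (intPerm (suc (suc k) ∷ ks)) i ≡ intPerm (suc k ∷ ks) i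
  remove-zero-shrink k ks i = cong pred (shrink (i <? suc k) (suc i <? suc k))
    where
    α = intPerm (suc (suc k) ∷ ks)
    α′ = intPerm (suc k ∷ ks)
    moved : ∀ {j} → α (suc i) ≡ suc j → bypass 0 α (suc i) ≡ suc j
    moved eq = trans (bypass-≢ {0} {α} {suc i} (λ α[i+1]≡0 → 0≢1+n (trans (sym α[i+1]≡0) eq))) eq
    shrink : Dec (i < suc k) → Dec (suc i < suc k) → bypass 0 α (suc i) ≡ suc (α′ i)
    shrink (no i≮k) _ = moved (trans (blockPerm-out (suc (suc k)) ks 0 (s≤s (≮⇒≥ i≮k)))
      (trans (blockPerm-suc ks (suc k) i) (cong suc (sym (blockPerm-out (suc k) ks 0 (≮⇒≥ i≮k))))))
    shrink (yes i<k) (yes i+1<k) = moved (trans (blockPerm-in (suc (suc k)) ks 0 (s≤s i<k))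
      (trans (cong (if_then 2+ i else 0) (<ᵇ-true (s≤s i+1<k)))
      (cong suc (sym (trans (blockPerm-in (suc k) ks 0 i<k) (cong (if_then suc i else 0) (<ᵇ-true i+1<k)))))))
    shrink (yes i<k) (no i+1≮k) = trans (bypass-≡ {0} {α} {suc i} (trans (blockPerm-in (suc (suc k)) ks 0 (s≤s i<k))
      (cong (if_then 2+ i else 0) (<ᵇ-false (s≤s (≮⇒≥ i+1≮k))))))
      (cong suc (sym (trans (blockPerm-in (suc k) ks 0 i<k) (cong (if_then suc i else 0) (<ᵇ-false (≮⇒≥ i+1≮k))))))

  -- Removing the point 0 from α deletes a singleton first block, or else shrinks the first block.
  numCycles-intPerm : ∀ c → Composition c → numCycles (sum c) (intPerm c) ≡ length c
  numCycles-intPerm []                   []        = refl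
  numCycles-intPerm (suc zero ∷ ks)      (_ ∷ pos) = begin
    numCycles (suc (sum ks)) α             ≡⟨ numCycles-remove-fixed (intPerm-perm (1 ∷ ks)) (s≤s z≤n) refl ⟩
    suc (numCycles (sum ks) (remove 0 α))  ≡⟨ cong suc (numCycles-remove≗ (intPerm-perm (1 ∷ ks)) (s≤s z≤n) drop-first) ⟩
    suc (numCycles (sum ks) (intPerm ks))  ≡⟨ cong suc (numCycles-intPerm ks pos) ⟩
    suc (length ks)                        ∎
    where
    open ≡-Reasoning
    α = intPerm (1 ∷ ks)
    drop-first : ∀ {i} → i < sum ks → remove 0 α i ≡ intPerm ks i
    drop-first {i} _ = cong pred (trans (bypass-fixed {0} {α} refl (suc i)) (blockPerm-suc ks 0 i))
  numCycles-intPerm (suc (suc k) ∷ ks) (_ ∷ pos) = begin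
    numCycles (sum c) (intPerm c)                      ≡⟨ numCycles-remove-moved (intPerm-perm c) (s≤s z≤n) (λ ()) ⟩
    numCycles (suc k + sum ks) (remove 0 (intPerm c))  ≡⟨ numCycles-remove≗ (intPerm-perm c) (s≤s z≤n) (λ {i} _ → remove-zero-shrink k ks i) ⟩
    numCycles (suc k + sum ks) (intPerm (suc k ∷ ks))  ≡⟨ numCycles-intPerm (suc k ∷ ks) (s≤s z≤n ∷ pos) ⟩
    length c                                           ∎
    where
    open ≡-Reasoning
    c = suc (suc k) ∷ ks

  length≤sum : ∀ {c} → Composition c → length c ≤ sum c
  length≤sum []          = z≤n
  length≤sum (0<k ∷ pos) = +-mono-≤ 0<k (length≤sum pos)

  blockPerm⁻¹-++ˡ : ∀ e ks s {j} → s ≤ j → j < s + sum e → blockPerm⁻¹ (e ++ ks) s j ≡ blockPerm⁻¹ e s j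
  blockPerm⁻¹-++ˡ []      ks s s≤j j<end = ⊥-elim (<⇒≱ j<end (subst (_≤ _) (sym (+-identityʳ s)) s≤j))
  blockPerm⁻¹-++ˡ (k ∷ e) ks s {j} s≤j j<end with j <? s + k
  ... | yes j<s+k = trans (blockPerm⁻¹-in k (e ++ ks) s j<s+k) (sym (blockPerm⁻¹-in k e s j<s+k))
  ... | no  j≮s+k = trans (blockPerm⁻¹-out k (e ++ ks) s (≮⇒≥ j≮s+k))
    (trans (blockPerm⁻¹-++ˡ e ks (s + k) (≮⇒≥ j≮s+k) (subst (j <_) (sym (+-assoc s k (sum e))) j<end))
           (sym (blockPerm⁻¹-out k e s (≮⇒≥ j≮s+k))))

  blockPerm⁻¹-++ʳ : ∀ e ks s {j} → s + sum e ≤ j → blockPerm⁻¹ (e ++ ks) s j ≡ blockPerm⁻¹ ks (s + sum e) j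
  blockPerm⁻¹-++ʳ []      ks s _ = cong (λ t → blockPerm⁻¹ ks t _) (sym (+-identityʳ s))
  blockPerm⁻¹-++ʳ (k ∷ e) ks s {j} s+[k+e]≤j =
    trans (blockPerm⁻¹-out k (e ++ ks) s (≤-trans (+-monoʳ-≤ s (m≤m+n k (sum e))) s+[k+e]≤j))
      (trans (blockPerm⁻¹-++ʳ e ks (s + k) (subst (_≤ j) (sym (+-assoc s k (sum e))) s+[k+e]≤j))
             (cong (λ t → blockPerm⁻¹ ks t j) (+-assoc s k (sum e))))

  blockPerm⁻¹-1∷ : ∀ e j → blockPerm⁻¹ (1 ∷ e) 0 (suc j) ≡ suc (blockPerm⁻¹ e 0 j)
  blockPerm⁻¹-1∷ e j = blockPerm⁻¹-suc e 0 j z≤n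

  blockPerm⁻¹-incHead-0 : ∀ {e} → Composition e → e ≢ [] → blockPerm⁻¹ (incHead e) 0 0 ≡ suc (blockPerm⁻¹ e 0 0)
  blockPerm⁻¹-incHead-0 {[]}         _         e≢[] = ⊥-elim (e≢[] refl)
  blockPerm⁻¹-incHead-0 {zero ∷ ks}  (() ∷ _)  _
  blockPerm⁻¹-incHead-0 {suc k ∷ ks} _         _    = refl

  blockPerm⁻¹-incHead-1 : ∀ {e} → Composition e → e ≢ [] → blockPerm⁻¹ (incHead e) 0 1 ≡ 0
  blockPerm⁻¹-incHead-1 {[]}         _ e≢[] = ⊥-elim (e≢[] refl)
  blockPerm⁻¹-incHead-1 {zero ∷ ks}  (() ∷ _) _
  blockPerm⁻¹-incHead-1 {suc k ∷ ks} _ _    = refl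

  blockPerm⁻¹-incHead-2+ : ∀ e j → blockPerm⁻¹ (incHead e) 0 (2+ j) ≡ suc (blockPerm⁻¹ e 0 (suc j))
  blockPerm⁻¹-incHead-2+ []       j = refl
  blockPerm⁻¹-incHead-2+ (k ∷ ks) j with suc j <? k
  ... | yes j+1<k = trans (blockPerm⁻¹-in (suc k) ks 0 (s≤s j+1<k)) (cong suc (sym (blockPerm⁻¹-in k ks 0 j+1<k)))
  ... | no  j+1≮k = trans (blockPerm⁻¹-out (suc k) ks 0 (s≤s (≮⇒≥ j+1≮k)))
    (trans (blockPerm⁻¹-suc ks k (suc j) (≮⇒≥ j+1≮k)) (cong suc (sym (blockPerm⁻¹-out k ks 0 (≮⇒≥ j+1≮k)))))

  blockPerm⁻¹-∷ʳ1-< : ∀ c {j} → j < sum c → blockPerm⁻¹ (c ++ [ 1 ]) 0 j ≡ blockPerm⁻¹ c 0 j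
  blockPerm⁻¹-∷ʳ1-< c j<n = blockPerm⁻¹-++ˡ c [ 1 ] 0 z≤n j<n

  blockPerm⁻¹-∷ʳ1-sum : ∀ c → blockPerm⁻¹ (c ++ [ 1 ]) 0 (sum c) ≡ sum c
  blockPerm⁻¹-∷ʳ1-sum c rewrite blockPerm⁻¹-++ʳ c [ 1 ] 0 {sum c} ≤-refl
                                | <ᵇ-true (subst (sum c <_) (+-comm 1 (sum c)) ≤-refl)
                                | ≡ᵇ-refl (sum c) = m+n∸n≡m (sum c) 1

  incLast : List ℕ → List ℕ
  incLast []            = []
  incLast (k ∷ [])      = suc k ∷ []
  incLast (k ∷ k′ ∷ ks) = k ∷ incLast (k′ ∷ ks)

  incLast-∷ʳ : ∀ e k → incLast (e ++ [ k ]) ≡ e ++ [ suc k ]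
  incLast-∷ʳ []           k = refl
  incLast-∷ʳ (a ∷ [])     k = refl
  incLast-∷ʳ (a ∷ b ∷ e)  k = cong (a ∷_) (incLast-∷ʳ (b ∷ e) k)

  ∷ʳ-view : ∀ (c : List ℕ) → c ≢ [] → ∃₂ λ c′ k → c ≡ c′ ++ [ k ]
  ∷ʳ-view []          c≢[] = ⊥-elim (c≢[] refl)
  ∷ʳ-view (a ∷ [])    _    = [] , a , refl
  ∷ʳ-view (a ∷ b ∷ c) _ with ∷ʳ-view (b ∷ c) (λ ())
  ... | c′ , k , eq = a ∷ c′ , k , cong (a ∷_) eq

  blockPerm⁻¹-lastBlock : ∀ c′ k {j} → sum c′ ≤ j → j < sum c′ + k →
    blockPerm⁻¹ (c′ ++ [ k ]) 0 j ≡ (if j ≡ᵇ sum c′ then pred (sum c′ + k) else pred j)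
  blockPerm⁻¹-lastBlock c′ k t≤j j<t+k = trans (blockPerm⁻¹-++ʳ c′ [ k ] 0 t≤j) (blockPerm⁻¹-in k [] (sum c′) j<t+k)

  -- Growing the last block inserts the new point sum c into the cycle of α⁻¹ right after pred (sum c).
  record IncLastInverse (c : List ℕ) : Set where
    field
      to-new    : ∀ {j} → j < sum c → blockPerm⁻¹ c 0 j ≡ pred (sum c) → blockPerm⁻¹ (incLast c) 0 j ≡ sum c
      unchanged : ∀ {j} → j < sum c → blockPerm⁻¹ c 0 j ≢ pred (sum c) → blockPerm⁻¹ (incLast c) 0 j ≡ blockPerm⁻¹ c 0 j
      from-new  : blockPerm⁻¹ (incLast c) 0 (sum c) ≡ pred (sum c)

  module _ (c′ : List ℕ) {k : ℕ} (0<k : 0 < k) where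

    private
      t = sum c′
      n = t + k
      c = c′ ++ [ k ]
      ι = blockPerm⁻¹ c 0
      ι′ = blockPerm⁻¹ (incLast c) 0
      sum-c : sum c ≡ n
      sum-c = trans (sum-++ c′ [ k ]) (cong (t +_) (+-identityʳ k))
      t<n : t < n
      t<n = subst (_≤ n) (+-comm t 1) (+-monoʳ-≤ t 0<k)
      n<n+1 : n < t + suc k
      n<n+1 = +-monoʳ-< t ≤-refl
      before : ∀ {j} → j < t → ∀ k′ → blockPerm⁻¹ (c′ ++ [ k′ ]) 0 j ≡ blockPerm⁻¹ c′ 0 j
      before j<t k′ = blockPerm⁻¹-++ˡ c′ [ k′ ] 0 z≤n j<t
      inLast : ∀ {j} → t ≤ j → j < n → ι j ≡ (if j ≡ᵇ t then pred n else pred j)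
      inLast = blockPerm⁻¹-lastBlock c′ k
      inLast′ : ∀ {j} → t ≤ j → j < t + suc k → ι′ j ≡ (if j ≡ᵇ t then pred (t + suc k) else pred j)
      inLast′ t≤j j<n+1 = trans (cong (λ e → blockPerm⁻¹ e 0 _) (incLast-∷ʳ c′ k)) (blockPerm⁻¹-lastBlock c′ (suc k) t≤j j<n+1)

    blockPerm⁻¹-incLast-to-new : ∀ {j} → j < sum c → ι j ≡ pred (sum c) → ι′ j ≡ sum c
    blockPerm⁻¹-incLast-to-new {j} j<c ιj≡ rewrite sum-c with j <? t
    ... | yes j<t = ⊥-elim (<⇒≱ (subst (_< t) (sym (before j<t k)) (proj₂ (blockPerm⁻¹-bounded c′ 0 z≤n j<t)))
                                (subst (t ≤_) (sym ιj≡) (<⇒≤pred t<n)))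
    ... | no j≮t with j ≟ t
    ...   | yes refl = trans (inLast′ ≤-refl (<-trans t<n n<n+1))
                         (trans (cong (if_then pred (t + suc k) else pred t) (≡ᵇ-refl t)) (cong pred (+-suc t k)))
    ...   | no  j≢t = ⊥-elim (<⇒≢ j<c (pred-injective {{>-nonZero (≤-<-trans z≤n t<j)}} {{>-nonZero (≤-<-trans z≤n t<n)}}
                        (trans (sym (trans (inLast (≮⇒≥ j≮t) j<c) (cong (if_then pred n else pred j) (≡ᵇ-false j≢t)))) ιj≡)))
      where t<j = ≤∧≢⇒< (≮⇒≥ j≮t) (j≢t ∘ sym)

    blockPerm⁻¹-incLast-unchanged : ∀ {j} → j < sum c → ι j ≢ pred (sum c) → ι′ j ≡ ι j
    blockPerm⁻¹-incLast-unchanged {j} j<c ιj≢ rewrite sum-c with j <? t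
    ... | yes j<t = trans (cong (λ e → blockPerm⁻¹ e 0 j) (incLast-∷ʳ c′ k)) (trans (before j<t (suc k)) (sym (before j<t k)))
    ... | no j≮t with j ≟ t
    ...   | yes refl = ⊥-elim (ιj≢ (trans (inLast ≤-refl t<n) (cong (if_then pred n else pred t) (≡ᵇ-refl t))))
    ...   | no  j≢t = trans (inLast′ (≮⇒≥ j≮t) (<-trans j<c n<n+1))
                        (trans (cong (if_then pred (t + suc k) else pred j) (≡ᵇ-false j≢t))
                               (sym (trans (inLast (≮⇒≥ j≮t) j<c) (cong (if_then pred n else pred j) (≡ᵇ-false j≢t)))))

    blockPerm⁻¹-incLast-from-new : ι′ (sum c) ≡ pred (sum c)
    blockPerm⁻¹-incLast-from-new rewrite sum-c = trans (inLast′ (m≤m+n t k) n<n+1)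
      (cong (if_then pred (t + suc k) else pred n) (≡ᵇ-false (<⇒≢ t<n ∘ sym)))

  incLastInverse-∷ʳ : ∀ c′ {k} → 0 < k → IncLastInverse (c′ ++ [ k ])
  incLastInverse-∷ʳ c′ 0<k = record
    { to-new    = blockPerm⁻¹-incLast-to-new c′ 0<k
    ; unchanged = blockPerm⁻¹-incLast-unchanged c′ 0<k
    ; from-new  = blockPerm⁻¹-incLast-from-new c′ 0<k
    }

  incLastInverse : ∀ c → Composition c → c ≢ [] → IncLastInverse c
  incLastInverse c pos c≢[] with ∷ʳ-view c c≢[]
  ... | c′ , k , refl with ++⁻ʳ c′ pos
  ...   | 0<k ∷ [] = incLastInverse-∷ʳ c′ 0<k

  sum-incLast : ∀ c → c ≢ [] → sum (incLast c) ≡ suc (sum c)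
  sum-incLast []           c≢[] = ⊥-elim (c≢[] refl)
  sum-incLast (k ∷ [])     _    = refl
  sum-incLast (k ∷ k′ ∷ c) _    = trans (cong (k +_) (sum-incLast (k′ ∷ c) (λ ()))) (+-suc k _)

  length-incLast : ∀ c → length (incLast c) ≡ length c
  length-incLast []           = refl
  length-incLast (k ∷ [])     = refl
  length-incLast (k ∷ k′ ∷ c) = cong suc (length-incLast (k′ ∷ c))

  incLast-composition : ∀ {c} → Composition c → Composition (incLast c)
  incLast-composition {[]}         []              = []
  incLast-composition {k ∷ []}     (_ ∷ [])        = s≤s z≤n ∷ []
  incLast-composition {k ∷ k′ ∷ c} (0<k ∷ pos)     = 0<k ∷ incLast-composition pos

  incLast≢[] : ∀ c → c ≢ [] → incLast c ≢ []
  incLast≢[] []           c≢[] = c≢[]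
  incLast≢[] (k ∷ [])     _    = λ ()
  incLast≢[] (k ∷ k′ ∷ c) _    = λ ()

  sum-incHead : ∀ c → c ≢ [] → sum (incHead c) ≡ suc (sum c)
  sum-incHead []      c≢[] = ⊥-elim (c≢[] refl)
  sum-incHead (k ∷ c) _    = refl

  sum-∷ʳ1 : ∀ c → sum (c ++ [ 1 ]) ≡ suc (sum c)
  sum-∷ʳ1 c = trans (sum-++ c [ 1 ]) (+-comm (sum c) 1)

  ∷ʳ≢[] : ∀ c {k : ℕ} → c ++ [ k ] ≢ []
  ∷ʳ≢[] c eq with ++-conicalʳ c _ eq
  ... | ()

  length-incHead : ∀ c → length (incHead c) ≡ length c
  length-incHead []      = refl
  length-incHead (_ ∷ _) = refl

  incHead-composition : ∀ {c} → Composition c → Composition (incHead c)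
  incHead-composition []        = []
  incHead-composition (_ ∷ pos) = s≤s z≤n ∷ pos

  ∷ʳ1-composition : ∀ {c} → Composition c → Composition (c ++ [ 1 ])
  ∷ʳ1-composition pos = ++⁺ pos (s≤s z≤n ∷ [])

  length-∷ʳ1 : ∀ (c : List ℕ) → length (c ++ [ 1 ]) ≡ 1 + length c
  length-∷ʳ1 c = trans (length-++ c) (+-comm (length c) 1)

  bothNew bothGrown newFirst-grownLast grownFirst-newLast : List ℕ → List ℕ
  bothNew            c = 1 ∷ c ++ [ 1 ]
  bothGrown          c = incHead (incLast c)
  newFirst-grownLast c = 1 ∷ incLast c
  grownFirst-newLast c = incHead (c ++ [ 1 ])

  rainbow-∸ : ∀ {n i} → i < n → n ∸ i ≡ suc (rainbow n i)
  rainbow-∸ {suc n} {i} (s≤s i≤n) = +-∸-assoc 1 i≤n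

  i+[1+rainbow]≡n : ∀ {n i} → i < n → i + suc (rainbow n i) ≡ n
  i+[1+rainbow]≡n {n} {i} i<n = trans (cong (i +_) (sym (rainbow-∸ i<n))) (m+[n∸m]≡n (<⇒≤ i<n))

  rainbow≡0⇒last : ∀ {n i} → i < n → rainbow n i ≡ 0 → suc i ≡ n
  rainbow≡0⇒last {n} {i} i<n r≡0 = trans (+-comm 1 i) (trans (cong (λ r → i + suc r) (sym r≡0)) (i+[1+rainbow]≡n i<n))

  rainbow≡suc⇒notLast : ∀ {n i j} → i < n → rainbow n i ≡ suc j → suc i < n
  rainbow≡suc⇒notLast {n} {i} {j} i<n r≡j+1 =
    subst (suc i <_) (trans (cong (λ r → i + suc r) (sym r≡j+1)) (i+[1+rainbow]≡n i<n))
          (subst (_≤ i + 2+ j) (+-comm i 2) (+-monoʳ-≤ i (s≤s (s≤s z≤n))))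

  sum-positive : ∀ c → Composition c → c ≢ [] → 0 < sum c
  sum-positive []       _         c≢[] = ⊥-elim (c≢[] refl)
  sum-positive (k ∷ ks) (0<k ∷ _) _    = ≤-trans 0<k (m≤m+n k (sum ks))

  module Extension (c : List ℕ) (pos : Composition c) (c≢[] : c ≢ []) where

    n = sum c
    ι = blockPerm⁻¹ c 0
    τ = α⁻¹β n c

    ι-bounded : ∀ {j} → j < n → ι j < n
    ι-bounded = bounded (intPerm⁻¹-perm c)

    0<n : 0 < n
    0<n = sum-positive c pos c≢[]

    suc-pred-n : suc (pred n) ≡ n
    suc-pred-n = suc-pred n {{>-nonZero 0<n}}

    r<n : ∀ {i} → i < n → rainbow n i < n
    r<n = bounded (rainbow-perm n)

    blockPerm⁻¹-incHead-n+1 : ∀ e → blockPerm⁻¹ (incHead e) 0 (suc n) ≡ suc (blockPerm⁻¹ e 0 n)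
    blockPerm⁻¹-incHead-n+1 e = begin
      blockPerm⁻¹ (incHead e) 0 (suc n)        ≡⟨ cong (blockPerm⁻¹ (incHead e) 0 ∘ suc) suc-pred-n ⟨
      blockPerm⁻¹ (incHead e) 0 (2+ (pred n))  ≡⟨ blockPerm⁻¹-incHead-2+ e (pred n) ⟩
      suc (blockPerm⁻¹ e 0 (suc (pred n)))     ≡⟨ cong (suc ∘ blockPerm⁻¹ e 0) suc-pred-n ⟩
      suc (blockPerm⁻¹ e 0 n)                  ∎
      where open ≡-Reasoning

    numCycles-bothNew : numCycles (2+ n) (α⁻¹β (2+ n) (bothNew c)) ≡ suc (numCycles n τ)
    numCycles-bothNew = begin
      numCycles (2+ n) σ             ≡⟨ numCycles-remove-moved σ-perm ≤-refl σ[n+1]≢n+1 ⟩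
      numCycles (suc n) ρ            ≡⟨ numCycles-remove-fixed ρ-perm (s≤s z≤n) ρ0≡0 ⟩
      suc (numCycles n (remove 0 ρ)) ≡⟨ cong suc (numCycles-remove≗ ρ-perm (s≤s z≤n) ρ′≗τ) ⟩
      suc (numCycles n τ)            ∎
      where
      open ≡-Reasoning
      e = c ++ [ 1 ]
      d = bothNew c
      σ = α⁻¹β (2+ n) d
      σ-perm = α⁻¹β-perm d (cong suc (sum-∷ʳ1 c))
      ρ = remove (suc n) σ
      ρ-perm = remove-perm σ-perm ≤-refl
      σ[n+1]≡0 : σ (suc n) ≡ 0
      σ[n+1]≡0 = cong (blockPerm⁻¹ d 0) (n∸n≡0 n)
      σ[n+1]≢n+1 : σ (suc n) ≢ suc n
      σ[n+1]≢n+1 eq = 0≢1+n (trans (sym σ[n+1]≡0) eq)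
      ρ0≡0 : ρ 0 ≡ 0
      ρ0≡0 = remove-≡ {suc n} {σ} {0} (trans (blockPerm⁻¹-1∷ e n) (cong suc (blockPerm⁻¹-∷ʳ1-sum c))) σ[n+1]≡0
      ρ′≗τ : ∀ {i} → i < n → remove 0 ρ i ≡ τ i
      ρ′≗τ {i} i<n = remove-≢ {0} {ρ} {i} (remove-< {suc n} {σ} {suc i} σ[i+1] (s≤s (ι-bounded (r<n i<n)))) (λ ())
        where
        r = rainbow n i
        σ[i+1] : σ (punchIn (suc n) (suc i)) ≡ suc (ι r)
        σ[i+1] = begin
          σ (punchIn (suc n) (suc i))   ≡⟨ cong σ (punchIn-< (s≤s i<n)) ⟩
          blockPerm⁻¹ d 0 (n ∸ i)       ≡⟨ cong (blockPerm⁻¹ d 0) (rainbow-∸ i<n) ⟩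
          blockPerm⁻¹ d 0 (suc r)       ≡⟨ blockPerm⁻¹-1∷ e r ⟩
          suc (blockPerm⁻¹ e 0 r)       ≡⟨ cong suc (blockPerm⁻¹-∷ʳ1-< c (r<n i<n)) ⟩
          suc (ι r)                     ∎

    numCycles-newFirst-grownLast : numCycles (2+ n) (α⁻¹β (2+ n) (newFirst-grownLast c)) ≡ numCycles n τ
    numCycles-newFirst-grownLast = begin
      numCycles (2+ n) σ        ≡⟨ numCycles-remove-moved σ-perm ≤-refl σ[n+1]≢n+1 ⟩
      numCycles (suc n) ρ       ≡⟨ numCycles-remove-moved ρ-perm (s≤s z≤n) ρ0≢0 ⟩
      numCycles n (remove 0 ρ)  ≡⟨ numCycles-remove≗ ρ-perm (s≤s z≤n) ρ′≗τ ⟩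
      numCycles n τ             ∎
      where
      open ≡-Reasoning
      open IncLastInverse (incLastInverse c pos c≢[])
      e = incLast c
      d = newFirst-grownLast c
      σ = α⁻¹β (2+ n) d
      σ-perm = α⁻¹β-perm d (cong suc (sum-incLast c c≢[]))
      ρ = remove (suc n) σ
      ρ-perm = remove-perm σ-perm ≤-refl
      σ[n+1]≡0 : σ (suc n) ≡ 0
      σ[n+1]≡0 = cong (blockPerm⁻¹ d 0) (n∸n≡0 n)
      σ[n+1]≢n+1 : σ (suc n) ≢ suc n
      σ[n+1]≢n+1 eq = 0≢1+n (trans (sym σ[n+1]≡0) eq)
      ρ0≡n : ρ 0 ≡ n
      ρ0≡n = remove-< {suc n} {σ} {0} (trans (blockPerm⁻¹-1∷ e n) (trans (cong suc from-new) suc-pred-n)) ≤-refl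
      ρ0≢0 : ρ 0 ≢ 0
      ρ0≢0 eq = <⇒≢ 0<n (sym (trans (sym ρ0≡n) eq))
      ρ′≗τ : ∀ {i} → i < n → remove 0 ρ i ≡ τ i
      ρ′≗τ {i} i<n = by-cases (ι r ≟ pred n)
        where
        r = rainbow n i
        σ[i+1] : σ (punchIn (suc n) (suc i)) ≡ suc (blockPerm⁻¹ e 0 r)
        σ[i+1] = trans (cong σ (punchIn-< (s≤s i<n))) (trans (cong (blockPerm⁻¹ d 0) (rainbow-∸ i<n)) (blockPerm⁻¹-1∷ e r))
        by-cases : Dec (ι r ≡ pred n) → remove 0 ρ i ≡ ι r
        by-cases (yes ιr≡n-1) = trans (remove-≡ {0} {ρ} {i} (remove-≡ {suc n} {σ} {suc i}
          (trans σ[i+1] (cong suc (to-new (r<n i<n) ιr≡n-1))) σ[n+1]≡0) ρ0≡n) (sym ιr≡n-1)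
        by-cases (no  ιr≢n-1) = remove-≢ {0} {ρ} {i} (remove-< {suc n} {σ} {suc i}
          (trans σ[i+1] (cong suc (unchanged (r<n i<n) ιr≢n-1))) (s≤s (ι-bounded (r<n i<n)))) (λ ())

    numCycles-grownFirst-newLast : numCycles (2+ n) (α⁻¹β (2+ n) (grownFirst-newLast c)) ≡ numCycles n τ
    numCycles-grownFirst-newLast = begin
      numCycles (2+ n) σ        ≡⟨ numCycles-remove-moved σ-perm ≤-refl σ[n+1]≢n+1 ⟩
      numCycles (suc n) ρ       ≡⟨ numCycles-remove-moved ρ-perm (s≤s z≤n) (λ ρ0≡0 → 0≢1+n (trans (sym ρ0≡0) ρ0≡ι0+1)) ⟩
      numCycles n (remove 0 ρ)  ≡⟨ numCycles-remove≗ ρ-perm (s≤s z≤n) ρ′≗τ ⟩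
      numCycles n τ             ∎
      where
      open ≡-Reasoning
      e = c ++ [ 1 ]
      e-pos = ∷ʳ1-composition pos
      d = grownFirst-newLast c
      σ = α⁻¹β (2+ n) d
      σ-perm = α⁻¹β-perm d (trans (sum-incHead e (∷ʳ≢[] c)) (cong suc (sum-∷ʳ1 c)))
      ρ = remove (suc n) σ
      ρ-perm = remove-perm σ-perm ≤-refl
      σ[n+1]≡ι0+1 : σ (suc n) ≡ suc (ι 0)
      σ[n+1]≡ι0+1 = trans (cong (blockPerm⁻¹ d 0) (n∸n≡0 n))
        (trans (blockPerm⁻¹-incHead-0 e-pos (∷ʳ≢[] c)) (cong suc (blockPerm⁻¹-∷ʳ1-< c 0<n)))
      σ[n+1]≢n+1 : σ (suc n) ≢ suc n
      σ[n+1]≢n+1 eq = <⇒≢ (ι-bounded 0<n) (suc-injective (trans (sym σ[n+1]≡ι0+1) eq))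
      ρ0≡ι0+1 : ρ 0 ≡ suc (ι 0)
      ρ0≡ι0+1 = trans (remove-≡ {suc n} {σ} {0} (trans (blockPerm⁻¹-incHead-n+1 e) (cong suc (blockPerm⁻¹-∷ʳ1-sum c)))
                                               σ[n+1]≡ι0+1)
                      (punchOut-< (s≤s (ι-bounded 0<n)))
      ρ′≗τ : ∀ {i} → i < n → remove 0 ρ i ≡ τ i
      ρ′≗τ {i} i<n = by-cases (rainbow n i) refl
        where
        σ[i+1] : ∀ {r} → rainbow n i ≡ r → σ (punchIn (suc n) (suc i)) ≡ blockPerm⁻¹ d 0 (suc r)
        σ[i+1] r≡ = trans (cong σ (punchIn-< (s≤s i<n))) (cong (blockPerm⁻¹ d 0) (trans (rainbow-∸ i<n) (cong suc r≡)))
        by-cases : ∀ r → rainbow n i ≡ r → remove 0 ρ i ≡ ι (rainbow n i)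
        by-cases zero r≡0 = trans (remove-≡ {0} {ρ} {i}
          (remove-< {suc n} {σ} {suc i} (trans (σ[i+1] r≡0) (blockPerm⁻¹-incHead-1 e-pos (∷ʳ≢[] c))) (s≤s z≤n)) ρ0≡ι0+1)
          (cong ι (sym r≡0))
        by-cases (suc j) r≡j+1 = remove-≢ {0} {ρ} {i} (remove-< {suc n} {σ} {suc i} σ[i+1]′ (s≤s (ι-bounded (r<n i<n)))) (λ ())
          where
          σ[i+1]′ : σ (punchIn (suc n) (suc i)) ≡ suc (ι (rainbow n i))
          σ[i+1]′ = trans (σ[i+1] r≡j+1) (trans (blockPerm⁻¹-incHead-2+ e j)
            (cong suc (trans (blockPerm⁻¹-∷ʳ1-< c (subst (_< n) r≡j+1 (r<n i<n))) (cong ι (sym r≡j+1)))))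

    α⁻¹β-bothGrown-punchIn : ∀ {i} → i < n →
      α⁻¹β (2+ n) (bothGrown c) (punchIn n (suc i)) ≡ suc (blockPerm⁻¹ (incLast c) 0 (rainbow n i))
    α⁻¹β-bothGrown-punchIn {i} i<n = by-cases (rainbow n i) refl
      where
      e = incLast c
      d = bothGrown c
      by-cases : ∀ r → rainbow n i ≡ r → blockPerm⁻¹ d 0 (rainbow (2+ n) (punchIn n (suc i))) ≡ suc (blockPerm⁻¹ e 0 (rainbow n i))
      by-cases zero r≡0 = begin
        blockPerm⁻¹ d 0 (rainbow (2+ n) (punchIn n (suc i)))  ≡⟨ cong (blockPerm⁻¹ d 0 ∘ rainbow (2+ n)) (punchIn-≥ (≤-reflexive (sym i+1≡n))) ⟩
        blockPerm⁻¹ d 0 (n ∸ suc i)                           ≡⟨ cong (λ m → blockPerm⁻¹ d 0 (n ∸ m)) i+1≡n ⟩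
        blockPerm⁻¹ d 0 (n ∸ n)                               ≡⟨ cong (blockPerm⁻¹ d 0) (n∸n≡0 n) ⟩
        blockPerm⁻¹ d 0 0                                     ≡⟨ blockPerm⁻¹-incHead-0 (incLast-composition pos) (incLast≢[] c c≢[]) ⟩
        suc (blockPerm⁻¹ e 0 0)                               ≡⟨ cong (suc ∘ blockPerm⁻¹ e 0) r≡0 ⟨
        suc (blockPerm⁻¹ e 0 (rainbow n i))                   ∎
        where
        open ≡-Reasoning
        i+1≡n = rainbow≡0⇒last i<n r≡0
      by-cases (suc j) r≡j+1 = begin
        blockPerm⁻¹ d 0 (rainbow (2+ n) (punchIn n (suc i)))  ≡⟨ cong (blockPerm⁻¹ d 0 ∘ rainbow (2+ n)) (punchIn-< (rainbow≡suc⇒notLast i<n r≡j+1)) ⟩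
        blockPerm⁻¹ d 0 (n ∸ i)                               ≡⟨ cong (blockPerm⁻¹ d 0) (trans (rainbow-∸ i<n) (cong suc r≡j+1)) ⟩
        blockPerm⁻¹ d 0 (2+ j)                                ≡⟨ blockPerm⁻¹-incHead-2+ e j ⟩
        suc (blockPerm⁻¹ e 0 (suc j))                         ≡⟨ cong (suc ∘ blockPerm⁻¹ e 0) r≡j+1 ⟨
        suc (blockPerm⁻¹ e 0 (rainbow n i))                   ∎
        where open ≡-Reasoning

    -- Here the point removed first is n rather than n + 1: σ swaps 0 and n.
    numCycles-bothGrown : numCycles (2+ n) (α⁻¹β (2+ n) (bothGrown c)) ≡ suc (numCycles n τ)
    numCycles-bothGrown = begin
      numCycles (2+ n) σ             ≡⟨ numCycles-remove-moved σ-perm (m<n⇒m<1+n ≤-refl) σn≢n ⟩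
      numCycles (suc n) ρ            ≡⟨ numCycles-remove-fixed ρ-perm (s≤s z≤n) ρ0≡0 ⟩
      suc (numCycles n (remove 0 ρ)) ≡⟨ cong suc (numCycles-remove≗ ρ-perm (s≤s z≤n) ρ′≗τ) ⟩
      suc (numCycles n τ)            ∎
      where
      open ≡-Reasoning
      open IncLastInverse (incLastInverse c pos c≢[])
      e = incLast c
      d = bothGrown c
      σ = α⁻¹β (2+ n) d
      σ-perm = α⁻¹β-perm d (trans (sum-incHead e (incLast≢[] c c≢[])) (cong suc (sum-incLast c c≢[])))
      ρ = remove n σ
      ρ-perm = remove-perm σ-perm (m<n⇒m<1+n ≤-refl)
      σn≡0 : σ n ≡ 0
      σn≡0 = trans (cong (blockPerm⁻¹ d 0) (m+n∸n≡m 1 n)) (blockPerm⁻¹-incHead-1 (incLast-composition pos) (incLast≢[] c c≢[]))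
      σn≢n : σ n ≢ n
      σn≢n eq = <⇒≢ 0<n (trans (sym σn≡0) eq)
      σ0≡n : σ 0 ≡ n
      σ0≡n = trans (blockPerm⁻¹-incHead-n+1 e) (trans (cong suc from-new) suc-pred-n)
      ρ0≡0 : ρ 0 ≡ 0
      ρ0≡0 = trans (remove-≡ {n} {σ} {0} (trans (cong σ (punchIn-< 0<n)) σ0≡n) σn≡0) (punchOut-< 0<n)
      ρ′≗τ : ∀ {i} → i < n → remove 0 ρ i ≡ τ i
      ρ′≗τ {i} i<n = remove-≢ {0} {ρ} {i} (ρ[i+1] (ι r ≟ pred n)) (λ ())
        where
        r = rainbow n i
        ρ[i+1] : Dec (ι r ≡ pred n) → ρ (suc i) ≡ suc (ι r)
        ρ[i+1] (yes ιr≡n-1) = trans (remove-≢ {n} {σ} {suc i}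
            (trans (α⁻¹β-bothGrown-punchIn i<n) (cong suc (to-new (r<n i<n) ιr≡n-1))) (<⇒≢ ≤-refl ∘ sym))
          (trans (punchOut-> ≤-refl) (trans (sym suc-pred-n) (cong suc (sym ιr≡n-1))))
        ρ[i+1] (no ιr≢n-1) = remove-< {n} {σ} {suc i}
          (trans (α⁻¹β-bothGrown-punchIn i<n) (cong suc (unchanged (r<n i<n) ιr≢n-1)))
          (subst (suc (ι r) <_) suc-pred-n (s≤s (≤∧≢⇒< (<⇒≤pred (ι-bounded (r<n i<n))) ιr≢n-1)))

  countWhere : {A : Set} → (A → Bool) → List A → ℕ
  countWhere p xs = length (filter (T? ∘ p) xs)

  module _ {A : Set} where

    countWhere-++ : ∀ (p : A → Bool) xs ys → countWhere p (xs ++ ys) ≡ countWhere p xs + countWhere p ys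
    countWhere-++ p xs ys = trans (cong length (filter-++ (T? ∘ p) xs ys)) (length-++ (filter (T? ∘ p) xs))

    countWhere-map : ∀ {B : Set} (p : B → Bool) (f : A → B) xs → countWhere p (map f xs) ≡ countWhere (p ∘ f) xs
    countWhere-map p f []       = refl
    countWhere-map p f (x ∷ xs) with p (f x)
    ... | true  = cong suc (countWhere-map p f xs)
    ... | false = countWhere-map p f xs

    countWhere-∷ : ∀ (p : A → Bool) x xs → countWhere p (x ∷ xs) ≡ indicator (p x) + countWhere p xs
    countWhere-∷ p x xs with p x
    ... | true  = refl
    ... | false = refl

    countWhere-none : ∀ {p : A → Bool} {xs} → All (λ x → p x ≡ false) xs → countWhere p xs ≡ 0
    countWhere-none {p} {xs = []}     []             = refl
    countWhere-none {p} {xs = x ∷ xs} (px≡false ∷ rest) rewrite px≡false = countWhere-none rest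

    countWhere-cong : ∀ {p q : A → Bool} {xs} → All (λ x → p x ≡ q x) xs → countWhere p xs ≡ countWhere q xs
    countWhere-cong {xs = []}     []             = refl
    countWhere-cong {p} {q} {xs = x ∷ xs} (px≡qx ∷ eqs) with p x | q x
    ... | true  | true  = cong suc (countWhere-cong eqs)
    ... | false | false = countWhere-cong eqs
    countWhere-cong {xs = x ∷ xs} (() ∷ _) | true | false
    countWhere-cong {xs = x ∷ xs} (() ∷ _) | false | true

  CompositionOf : ℕ → List ℕ → Set
  CompositionOf n c = Composition c × c ≢ [] × sum c ≡ n

  comps⁺-compositions : ∀ m → All (CompositionOf (suc m)) (comps⁺ m)
  comps⁺-compositions zero    = ((s≤s z≤n ∷ []) , (λ ()) , refl) ∷ []
  comps⁺-compositions (suc m) = ++⁺ (map⁺ (All.map new-first (comps⁺-compositions m)))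
                                    (map⁺ (All.map grown-first (comps⁺-compositions m)))
    where
    new-first : ∀ {c} → CompositionOf (suc m) c → CompositionOf (2+ m) (1 ∷ c)
    new-first (pos , _ , sum≡) = (s≤s z≤n ∷ pos) , (λ ()) , cong suc sum≡
    grown-first : ∀ {c} → CompositionOf (suc m) c → CompositionOf (2+ m) (incHead c)
    grown-first {[]}    (_ , []≢[] , _)       = ⊥-elim ([]≢[] refl)
    grown-first {k ∷ c} (_ ∷ pos , _ , sum≡)  = (s≤s z≤n ∷ pos) , (λ ()) , cong suc sum≡

  incHead-∷ʳ : ∀ c {k} → c ≢ [] → incHead c ++ [ k ] ≡ incHead (c ++ [ k ])
  incHead-∷ʳ []      c≢[] = ⊥-elim (c≢[] refl)
  incHead-∷ʳ (_ ∷ _) _    = refl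

  incLast-∷ : ∀ c {k} → c ≢ [] → incLast (k ∷ c) ≡ k ∷ incLast c
  incLast-∷ []      c≢[] = ⊥-elim (c≢[] refl)
  incLast-∷ (_ ∷ _) _    = refl

  incLast-incHead : ∀ c → c ≢ [] → incLast (incHead c) ≡ incHead (incLast c)
  incLast-incHead []          c≢[] = ⊥-elim (c≢[] refl)
  incLast-incHead (_ ∷ [])    _    = refl
  incLast-incHead (_ ∷ _ ∷ _) _    = refl

  countWhere-comps⁺-first : ∀ m p →
    countWhere p (comps⁺ (suc m)) ≡ countWhere (p ∘ (1 ∷_)) (comps⁺ m) + countWhere (p ∘ incHead) (comps⁺ m)
  countWhere-comps⁺-first m p = trans (countWhere-++ p (map (1 ∷_) (comps⁺ m)) (map incHead (comps⁺ m)))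
    (cong₂ _+_ (countWhere-map p (1 ∷_) (comps⁺ m)) (countWhere-map p incHead (comps⁺ m)))

  countWhere-comps⁺-last : ∀ m p →
    countWhere p (comps⁺ (suc m)) ≡ countWhere (p ∘ (_++ [ 1 ])) (comps⁺ m) + countWhere (p ∘ incLast) (comps⁺ m)
  countWhere-comps⁺-last zero p
    rewrite countWhere-∷ p (1 ∷ 1 ∷ []) ((2 ∷ []) ∷ []) | countWhere-∷ p (2 ∷ []) []
          | countWhere-∷ (p ∘ (_++ [ 1 ])) (1 ∷ []) [] | countWhere-∷ (p ∘ incLast) (1 ∷ []) []
          = cong (_+ (indicator (p (2 ∷ [])) + 0)) (sym (+-identityʳ (indicator (p (1 ∷ 1 ∷ [])))))
  countWhere-comps⁺-last (suc m) p = begin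
    countWhere p (comps⁺ (2+ m))
      ≡⟨ countWhere-comps⁺-first (suc m) p ⟩
    countWhere (p ∘ (1 ∷_)) Y + countWhere (p ∘ incHead) Y
      ≡⟨ cong₂ _+_ (countWhere-comps⁺-last m (p ∘ (1 ∷_))) (countWhere-comps⁺-last m (p ∘ incHead)) ⟩
    (#[ p ∘ bothNew ] + #[ p ∘ (1 ∷_) ∘ incLast ]) + (#[ p ∘ incHead ∘ (_++ [ 1 ]) ] + #[ p ∘ incHead ∘ incLast ])
      ≡⟨ cong₂ _+_ (cong (#[ p ∘ bothNew ] +_) (commute (λ c → incLast-∷ c)))
                   (cong₂ _+_ (commute (λ c → incHead-∷ʳ c)) (commute incLast-incHead)) ⟨
    (#[ p ∘ bothNew ] + #[ p ∘ incLast ∘ (1 ∷_) ]) + (#[ p ∘ (_++ [ 1 ]) ∘ incHead ] + #[ p ∘ incLast ∘ incHead ])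
      ≡⟨ interchange #[ p ∘ bothNew ] _ _ _ ⟩
    (#[ p ∘ bothNew ] + #[ p ∘ (_++ [ 1 ]) ∘ incHead ]) + (#[ p ∘ incLast ∘ (1 ∷_) ] + #[ p ∘ incLast ∘ incHead ])
      ≡⟨ cong₂ _+_ (countWhere-comps⁺-first m (p ∘ (_++ [ 1 ]))) (countWhere-comps⁺-first m (p ∘ incLast)) ⟨
    countWhere (p ∘ (_++ [ 1 ])) Y + countWhere (p ∘ incLast) Y ∎
    where
    open ≡-Reasoning
    X = comps⁺ m
    Y = comps⁺ (suc m)
    #[_] : (List ℕ → Bool) → ℕ
    #[ q ] = countWhere q X
    commute : ∀ {f g : List ℕ → List ℕ} → (∀ c → c ≢ [] → f c ≡ g c) → #[ p ∘ f ] ≡ #[ p ∘ g ]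
    commute f≡g = countWhere-cong (All.map (λ (_ , c≢[] , _) → cong p (f≡g _ c≢[])) (comps⁺-compositions m))

  ‖α⁻¹β‖ : ℕ → List ℕ → ℕ
  ‖α⁻¹β‖ N c = norm N (inv N (intPerm c) ∘ₚ rainbow N)

  ‖α‖ : ℕ → List ℕ → ℕ
  ‖α‖ N c = norm N (intPerm c)

  ‖α⁻¹β‖≡ : ∀ {N} c → sum c ≡ N → ‖α⁻¹β‖ N c ≡ N ∸ numCycles N (α⁻¹β N c)
  ‖α⁻¹β‖≡ c refl = cong (sum c ∸_) (numCycles-α⁻¹β c)

  ‖α‖≡ : ∀ {N c} → Composition c → sum c ≡ N → ‖α‖ N c ≡ N ∸ length c
  ‖α‖≡ {c = c} pos refl = cong (sum c ∸_) (numCycles-intPerm c pos)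

  2+n∸[k+m] : ∀ {n m} k → k ≤ 2 → m ≤ n → 2+ n ∸ (k + m) ≡ (n ∸ m) + (2 ∸ k)
  2+n∸[k+m] 0 _ m≤n = trans (+-∸-assoc 2 m≤n) (+-comm 2 _)
  2+n∸[k+m] 1 _ m≤n = trans (+-∸-assoc 1 m≤n) (+-comm 1 _)
  2+n∸[k+m] {n} {m} 2 _ _ = sym (+-identityʳ (n ∸ m))
  2+n∸[k+m] (suc (suc (suc _))) (s≤s (s≤s ())) _

  ‖α⁻¹β‖-extend : ∀ {c d k} → sum d ≡ 2+ (sum c) → k ≤ 2 →
    numCycles (2+ (sum c)) (α⁻¹β (2+ (sum c)) d) ≡ k + numCycles (sum c) (α⁻¹β (sum c) c) →
    ‖α⁻¹β‖ (2+ (sum c)) d ≡ ‖α⁻¹β‖ (sum c) c + (2 ∸ k)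
  ‖α⁻¹β‖-extend {c} {d} {k} sum-d k≤2 cycles = begin
    ‖α⁻¹β‖ (2+ (sum c)) d                                      ≡⟨ ‖α⁻¹β‖≡ d sum-d ⟩
    2+ (sum c) ∸ numCycles (2+ (sum c)) (α⁻¹β (2+ (sum c)) d)  ≡⟨ cong (2+ (sum c) ∸_) cycles ⟩
    2+ (sum c) ∸ (k + K)                                       ≡⟨ 2+n∸[k+m] k k≤2 (numCycles≤ (sum c) _) ⟩
    (sum c ∸ K) + (2 ∸ k)                                      ≡⟨ cong (_+ (2 ∸ k)) (‖α⁻¹β‖≡ c refl) ⟨
    ‖α⁻¹β‖ (sum c) c + (2 ∸ k)                                 ∎
    where
    open ≡-Reasoning
    K = numCycles (sum c) (α⁻¹β (sum c) c)

  ‖α‖-extend : ∀ {c d k} → Composition c → Composition d → sum d ≡ 2+ (sum c) → k ≤ 2 →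
    length d ≡ k + length c → ‖α‖ (2+ (sum c)) d ≡ ‖α‖ (sum c) c + (2 ∸ k)
  ‖α‖-extend {c} {d} {k} c-pos d-pos sum-d k≤2 blocks = begin
    ‖α‖ (2+ (sum c)) d              ≡⟨ ‖α‖≡ d-pos sum-d ⟩
    2+ (sum c) ∸ length d           ≡⟨ cong (2+ (sum c) ∸_) blocks ⟩
    2+ (sum c) ∸ (k + length c)     ≡⟨ 2+n∸[k+m] k k≤2 (length≤sum c-pos) ⟩
    (sum c ∸ length c) + (2 ∸ k)    ≡⟨ cong (_+ (2 ∸ k)) (‖α‖≡ c-pos refl) ⟨
    ‖α‖ (sum c) c + (2 ∸ k)         ∎
    where open ≡-Reasoning

  Raises : (List ℕ → List ℕ) → ℕ → ℕ → Set
  Raises t dy da = ∀ {c} → Composition c → c ≢ [] →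
    ‖α⁻¹β‖ (2+ (sum c)) (t c) ≡ ‖α⁻¹β‖ (sum c) c + dy × ‖α‖ (2+ (sum c)) (t c) ≡ ‖α‖ (sum c) c + da

  bothNew-raises : Raises bothNew 1 0
  bothNew-raises {c} pos c≢[] =
    ‖α⁻¹β‖-extend {c} {bothNew c} sum-d (s≤s z≤n) numCycles-bothNew ,
    ‖α‖-extend pos (s≤s z≤n ∷ ∷ʳ1-composition pos) sum-d ≤-refl (cong suc (length-∷ʳ1 c))
    where
    open Extension c pos c≢[]
    sum-d = cong suc (sum-∷ʳ1 c)

  bothGrown-raises : Raises bothGrown 1 2
  bothGrown-raises {c} pos c≢[] =
    ‖α⁻¹β‖-extend {c} {bothGrown c} sum-d (s≤s z≤n) numCycles-bothGrown ,
    ‖α‖-extend pos (incHead-composition (incLast-composition pos)) sum-d z≤n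
      (trans (length-incHead (incLast c)) (length-incLast c))
    where
    open Extension c pos c≢[]
    sum-d = trans (sum-incHead (incLast c) (incLast≢[] c c≢[])) (cong suc (sum-incLast c c≢[]))

  newFirst-grownLast-raises : Raises newFirst-grownLast 2 1
  newFirst-grownLast-raises {c} pos c≢[] =
    ‖α⁻¹β‖-extend {c} {newFirst-grownLast c} sum-d z≤n numCycles-newFirst-grownLast ,
    ‖α‖-extend pos (s≤s z≤n ∷ incLast-composition pos) sum-d (s≤s z≤n) (cong suc (length-incLast c))
    where
    open Extension c pos c≢[]
    sum-d = cong suc (sum-incLast c c≢[])

  grownFirst-newLast-raises : Raises grownFirst-newLast 2 1
  grownFirst-newLast-raises {c} pos c≢[] =
    ‖α⁻¹β‖-extend {c} {grownFirst-newLast c} sum-d z≤n numCycles-grownFirst-newLast ,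
    ‖α‖-extend pos (incHead-composition (∷ʳ1-composition pos)) sum-d (s≤s z≤n)
      (trans (length-incHead (c ++ [ 1 ])) (length-∷ʳ1 c))
    where
    open Extension c pos c≢[]
    sum-d = trans (sum-incHead (c ++ [ 1 ]) (∷ʳ≢[] c)) (cong suc (sum-∷ʳ1 c))

  hasNorms : ℕ → ℕ → ℕ → List ℕ → Bool
  hasNorms N i j c = (‖α⁻¹β‖ N c ≡ᵇ i) ∧ (‖α‖ N c ≡ᵇ j)

  Count : ℕ → ℕ → ℕ → ℕ
  Count N i j = countWhere (hasNorms N i j) (Int N)

  shiftYA : ℕ → ℕ → (ℕ → ℕ → ℕ) → ℕ → ℕ → ℕ
  shiftYA dy da f i j = if dy ≤ᵇ i then (if da ≤ᵇ j then f (i ∸ dy) (j ∸ da) else 0) else 0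

  +-≡ᵇ : ∀ y {d i} → d ≤ i → (y + d ≡ᵇ i) ≡ (y ≡ᵇ i ∸ d)
  +-≡ᵇ y {d} {i} d≤i = T-⇔⇒≡ (mk⇔
    (λ t → ≡⇒≡ᵇ y (i ∸ d) (trans (sym (m+n∸n≡m y d)) (cong (_∸ d) (≡ᵇ⇒≡ (y + d) i t))))
    (λ t → ≡⇒≡ᵇ (y + d) i (trans (cong (_+ d) (≡ᵇ⇒≡ y (i ∸ d) t)) (m∸n+n≡m d≤i))))

  +-≡ᵇ-false : ∀ y {d i} → ¬ d ≤ i → (y + d ≡ᵇ i) ≡ false
  +-≡ᵇ-false y {d} {i} d≰i = T-⇔⇒≡ (mk⇔ (λ t → d≰i (subst (d ≤_) (≡ᵇ⇒≡ (y + d) i t) (m≤n+m d y))) λ ())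

  raises-at : ∀ {t dy da n c} → Raises t dy da → CompositionOf n c →
    ‖α⁻¹β‖ (2+ n) (t c) ≡ ‖α⁻¹β‖ n c + dy × ‖α‖ (2+ n) (t c) ≡ ‖α‖ n c + da
  raises-at {t} {dy} {da} {c = c} raises (pos , c≢[] , sum≡n) =
    subst (λ n → ‖α⁻¹β‖ (2+ n) (t c) ≡ ‖α⁻¹β‖ n c + dy × ‖α‖ (2+ n) (t c) ≡ ‖α‖ n c + da) sum≡n (raises pos c≢[])

  countWhere-raised : ∀ {t dy da} → Raises t dy da → ∀ m i j →
    countWhere (hasNorms (2+ (suc m)) i j ∘ t) (comps⁺ m) ≡ shiftYA dy da (Count (suc m)) i j
  countWhere-raised {t} {dy} {da} raises m i j with dy ≤? i | da ≤? j
  ... | yes dy≤i | yes da≤j rewrite ≤ᵇ-true dy≤i | ≤ᵇ-true da≤j = countWhere-cong (All.map pointwise (comps⁺-compositions m))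
    where
    pointwise : ∀ {c} → CompositionOf (suc m) c → hasNorms (2+ (suc m)) i j (t c) ≡ hasNorms (suc m) (i ∸ dy) (j ∸ da) c
    pointwise {c} c-comp with raises-at {t} raises c-comp
    ... | y≡ , a≡ = cong₂ _∧_ (trans (cong (_≡ᵇ i) y≡) (+-≡ᵇ (‖α⁻¹β‖ (suc m) c) dy≤i)) (trans (cong (_≡ᵇ j) a≡) (+-≡ᵇ (‖α‖ (suc m) c) da≤j))
  ... | yes dy≤i | no da≰j rewrite ≤ᵇ-true dy≤i | ≤ᵇ-false da≰j = countWhere-none (All.map none (comps⁺-compositions m))
    where
    none : ∀ {c} → CompositionOf (suc m) c → hasNorms (2+ (suc m)) i j (t c) ≡ false
    none {c} c-comp = trans (cong (λ a → (‖α⁻¹β‖ (2+ (suc m)) (t c) ≡ᵇ i) ∧ (a ≡ᵇ j)) (proj₂ (raises-at {t} raises c-comp)))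
      (trans (cong ((‖α⁻¹β‖ (2+ (suc m)) (t c) ≡ᵇ i) ∧_) (+-≡ᵇ-false (‖α‖ (suc m) c) da≰j)) (∧-zeroʳ _))
  ... | no dy≰i | _ rewrite ≤ᵇ-false dy≰i = countWhere-none (All.map none (comps⁺-compositions m))
    where
    none : ∀ {c} → CompositionOf (suc m) c → hasNorms (2+ (suc m)) i j (t c) ≡ false
    none {c} c-comp = trans (cong (λ y → (y ≡ᵇ i) ∧ (‖α‖ (2+ (suc m)) (t c) ≡ᵇ j)) (proj₁ (raises-at {t} raises c-comp)))
      (cong (_∧ (‖α‖ (2+ (suc m)) (t c) ≡ᵇ j)) (+-≡ᵇ-false (‖α⁻¹β‖ (suc m) c) dy≰i))

  Count-recurrence : ∀ m i j → let C = Count (suc m) in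
    Count (2+ (suc m)) i j ≡ (shiftYA 1 0 C i j + shiftYA 2 1 C i j) + (shiftYA 2 1 C i j + shiftYA 1 2 C i j)
  Count-recurrence m i j = begin
    countWhere p (comps⁺ (2+ m))
      ≡⟨ countWhere-comps⁺-first (suc m) p ⟩
    countWhere (p ∘ (1 ∷_)) (comps⁺ (suc m)) + countWhere (p ∘ incHead) (comps⁺ (suc m))
      ≡⟨ cong₂ _+_ (countWhere-comps⁺-last m (p ∘ (1 ∷_))) (countWhere-comps⁺-last m (p ∘ incHead)) ⟩
    (#[ p ∘ bothNew ] + #[ p ∘ newFirst-grownLast ]) + (#[ p ∘ grownFirst-newLast ] + #[ p ∘ bothGrown ])
      ≡⟨ cong₂ _+_ (cong₂ _+_ (countWhere-raised {bothNew} bothNew-raises m i j)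
                              (countWhere-raised {newFirst-grownLast} newFirst-grownLast-raises m i j))
                   (cong₂ _+_ (countWhere-raised {grownFirst-newLast} grownFirst-newLast-raises m i j)
                              (countWhere-raised {bothGrown} bothGrown-raises m i j)) ⟩
    (shiftYA 1 0 C i j + shiftYA 2 1 C i j) + (shiftYA 2 1 C i j + shiftYA 1 2 C i j) ∎
    where
    open ≡-Reasoning
    p = hasNorms (2+ (suc m)) i j
    C = Count (suc m)
    #[_] : (List ℕ → Bool) → ℕ
    #[ q ] = countWhere q (comps⁺ m)

module PowerSeries where

  open CycleCounting using (≤ᵇ-true; ≤ᵇ-false; ≡ᵇ-refl; ≡ᵇ-false)
  open IntervalPartitions using (Count; shiftYA; Count-recurrence)
  open import Data.Nat as ℕ using (zero; suc; _∸_; _≤ᵇ_; _≡ᵇ_)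
  import Data.Nat.Properties as ℕ
  open import Data.Integer using (ℤ; +_; -_; _+_; _*_; _-_)
  open import Data.Integer.Properties using (+-identityˡ; +-identityʳ; *-zeroʳ; *-identityˡ; *-distribˡ-+; pos-+)
  open import Data.Integer.Tactic.RingSolver using (solve-∀)
  open import Data.Bool using (true; false; if_then_else_)
  open import Data.List using (List; []; _∷_; upTo; foldr)
  open import Data.List.Properties using (map-upTo; foldr-map)
  open import Function using (_∘_)
  open import Relation.Binary.Definitions using (Tri; tri<; tri≈; tri>)
  open import Relation.Binary.PropositionalEquality

  ΣL : List ℕ → (ℕ → ℤ) → ℤ
  ΣL xs f = foldr (λ a r → f a + r) (+ 0) xs

  ΣL-+ : ∀ xs f g → ΣL xs (λ a → f a + g a) ≡ ΣL xs f + ΣL xs g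
  ΣL-+ []       f g = refl
  ΣL-+ (x ∷ xs) f g = trans (cong (λ r → f x + g x + r) (ΣL-+ xs f g)) (interchange (f x) (g x) _ _)
    where
    interchange : ∀ a b c d → a + b + (c + d) ≡ a + c + (b + d)
    interchange = solve-∀

  ΣL-*ˡ : ∀ xs k f → ΣL xs (λ a → k * f a) ≡ k * ΣL xs f
  ΣL-*ˡ []       k f = sym (*-zeroʳ k)
  ΣL-*ˡ (x ∷ xs) k f = trans (cong (λ r → k * f x + r) (ΣL-*ˡ xs k f)) (distrib k (f x) _)
    where
    distrib : ∀ k a b → k * a + k * b ≡ k * (a + b)
    distrib = solve-∀

  ΣL-cong : ∀ xs {f g : ℕ → ℤ} → (∀ a → f a ≡ g a) → ΣL xs f ≡ ΣL xs g
  ΣL-cong []       f≗g = refl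
  ΣL-cong (x ∷ xs) f≗g = cong₂ _+_ (f≗g x) (ΣL-cong xs f≗g)

  Σ≤-peel : ∀ n (f : ℕ → ℤ) → Σ≤ (suc n) f ≡ f 0 + Σ≤ n (f ∘ suc)
  Σ≤-peel n f = cong (λ r → f 0 + r) (trans (cong (λ xs → ΣL xs f) (sym (map-upTo suc (suc n))))
                                     (foldr-map (λ a r → f a + r) suc (+ 0) (upTo (suc n))))

  δ : ℕ → ℕ → ℤ
  δ a p = if a ≡ᵇ p then + 1 else + 0

  Σ≤-pick : ∀ n p (f : ℕ → ℤ) → Σ≤ n (λ a → δ (n ∸ a) p * f a) ≡ (if p ≤ᵇ n then f (n ∸ p) else + 0)
  Σ≤-pick zero zero    f = trans (+-identityʳ _) (*-identityˡ (f 0))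
  Σ≤-pick zero (suc p) f = refl
  Σ≤-pick (suc n) p f = begin
    Σ≤ (suc n) (λ a → δ (suc n ∸ a) p * f a)                      ≡⟨ Σ≤-peel n (λ a → δ (suc n ∸ a) p * f a) ⟩
    δ (suc n) p * f 0 + Σ≤ n (λ a → δ (n ∸ a) p * f (suc a))      ≡⟨ cong (λ r → δ (suc n) p * f 0 + r) (Σ≤-pick n p (f ∘ suc)) ⟩
    δ (suc n) p * f 0 + (if p ≤ᵇ n then f (suc (n ∸ p)) else + 0) ≡⟨ by-cases (ℕ.<-cmp p (suc n)) ⟩
    (if p ≤ᵇ suc n then f (suc n ∸ p) else + 0)                    ∎
    where
    open ≡-Reasoning
    by-cases : Tri (p ℕ.< suc n) (p ≡ suc n) (suc n ℕ.< p) →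
      δ (suc n) p * f 0 + (if p ≤ᵇ n then f (suc (n ∸ p)) else + 0) ≡ (if p ≤ᵇ suc n then f (suc n ∸ p) else + 0)
    by-cases (tri< p<n+1 p≢n+1 _)
      rewrite ≡ᵇ-false (p≢n+1 ∘ sym) | ≤ᵇ-true (ℕ.s≤s⁻¹ p<n+1) | ≤ᵇ-true (ℕ.<⇒≤ p<n+1)
      = trans (+-identityˡ _) (cong f (sym (ℕ.+-∸-assoc 1 (ℕ.s≤s⁻¹ p<n+1))))
    by-cases (tri≈ _ refl _)
      rewrite ≡ᵇ-refl (suc n) | ≤ᵇ-false (ℕ.1+n≰n {n}) | ≤ᵇ-true (ℕ.≤-refl {suc n}) | ℕ.n∸n≡0 n
      = trans (+-identityʳ _) (*-identityˡ (f 0))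
    by-cases (tri> _ p≢n+1 n+1<p)
      rewrite ≡ᵇ-false (p≢n+1 ∘ sym) | ≤ᵇ-false (ℕ.<⇒≱ (ℕ.<-trans (ℕ.n<1+n n) n+1<p)) | ≤ᵇ-false (ℕ.<⇒≱ n+1<p)
      = refl

  Σ³ : ℕ → ℕ → ℕ → (ℕ → ℕ → ℕ → ℤ) → ℤ
  Σ³ n i j h = Σ≤ n λ a → Σ≤ i λ b → Σ≤ j λ c → h a b c

  Σ³-cong : ∀ n i j {h h′ : ℕ → ℕ → ℕ → ℤ} → (∀ a b c → h a b c ≡ h′ a b c) → Σ³ n i j h ≡ Σ³ n i j h′
  Σ³-cong n i j h≗h′ = ΣL-cong (upTo (suc n)) λ a → ΣL-cong (upTo (suc i)) λ b → ΣL-cong (upTo (suc j)) (h≗h′ a b)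

  Σ³-+ : ∀ n i j (h h′ : ℕ → ℕ → ℕ → ℤ) → Σ³ n i j (λ a b c → h a b c + h′ a b c) ≡ Σ³ n i j h + Σ³ n i j h′
  Σ³-+ n i j h h′ = trans (ΣL-cong (upTo (suc n)) λ a →
      trans (ΣL-cong (upTo (suc i)) λ b → ΣL-+ (upTo (suc j)) (h a b) (h′ a b))
            (ΣL-+ (upTo (suc i)) (λ b → Σ≤ j (h a b)) (λ b → Σ≤ j (h′ a b))))
    (ΣL-+ (upTo (suc n)) (λ a → Σ≤ i λ b → Σ≤ j (h a b)) (λ a → Σ≤ i λ b → Σ≤ j (h′ a b)))

  Σ³-*ˡ : ∀ n i j k (h : ℕ → ℕ → ℕ → ℤ) → Σ³ n i j (λ a b c → k * h a b c) ≡ k * Σ³ n i j h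
  Σ³-*ˡ n i j k h = trans (ΣL-cong (upTo (suc n)) λ a →
      trans (ΣL-cong (upTo (suc i)) λ b → ΣL-*ˡ (upTo (suc j)) k (h a b))
            (ΣL-*ˡ (upTo (suc i)) k (λ b → Σ≤ j (h a b))))
    (ΣL-*ˡ (upTo (suc n)) k (λ a → Σ≤ i λ b → Σ≤ j (h a b)))

  infixl 6 _⊕_
  infixl 7 _·_

  _⊕_ : Series → Series → Series
  (F ⊕ G) n i j = F n i j + G n i j

  _·_ : ℤ → Series → Series
  (k · F) n i j = k * F n i j

  monomial : ℕ → ℕ → ℕ → Series
  monomial p q r x y z = δ x p * (δ y q * δ z r)

  -- The coefficients of X^p Y^q A^r F.
  shiftXYA : ℕ → ℕ → ℕ → Series → Series
  shiftXYA p q r F n i j =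
    if p ≤ᵇ n then (if q ≤ᵇ i then (if r ≤ᵇ j then F (n ∸ p) (i ∸ q) (j ∸ r) else + 0) else + 0) else + 0

  ⋆-congʳ : ∀ F {G H} → (∀ x y z → G x y z ≡ H x y z) → ∀ n i j → (F ⋆ G) n i j ≡ (F ⋆ H) n i j
  ⋆-congʳ F G≗H n i j = Σ³-cong n i j λ a b c → cong (F a b c *_) (G≗H (n ∸ a) (i ∸ b) (j ∸ c))

  ⋆-⊕ʳ : ∀ F G H n i j → (F ⋆ (G ⊕ H)) n i j ≡ (F ⋆ G) n i j + (F ⋆ H) n i j
  ⋆-⊕ʳ F G H n i j = trans (Σ³-cong n i j λ a b c → *-distribˡ-+ (F a b c) _ _)
    (Σ³-+ n i j (λ a b c → F a b c * G (n ∸ a) (i ∸ b) (j ∸ c)) (λ a b c → F a b c * H (n ∸ a) (i ∸ b) (j ∸ c)))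

  ⋆-·ʳ : ∀ F k G n i j → (F ⋆ (k · G)) n i j ≡ k * (F ⋆ G) n i j
  ⋆-·ʳ F k G n i j = trans (Σ³-cong n i j λ a b c → x*[k*y]≡k*[x*y] (F a b c) k _)
    (Σ³-*ˡ n i j k (λ a b c → F a b c * G (n ∸ a) (i ∸ b) (j ∸ c)))
    where
    x*[k*y]≡k*[x*y] : ∀ x k y → x * (k * y) ≡ k * (x * y)
    x*[k*y]≡k*[x*y] = solve-∀

  ⋆-monomial : ∀ F p q r n i j → (F ⋆ monomial p q r) n i j ≡ shiftXYA p q r F n i j
  ⋆-monomial F p q r n i j = begin
    Σ³ n i j (λ a b c → F a b c * (δ (n ∸ a) p * (δ (i ∸ b) q * δ (j ∸ c) r)))
      ≡⟨ Σ³-cong n i j (λ a b c → rearrange (F a b c) (δ (n ∸ a) p) (δ (i ∸ b) q) (δ (j ∸ c) r)) ⟩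
    Σ³ n i j (λ a b c → δ (n ∸ a) p * (δ (i ∸ b) q * (δ (j ∸ c) r * F a b c)))
      ≡⟨ ΣL-cong (upTo (suc n)) (λ a → trans (ΣL-cong (upTo (suc i)) (pick-c a))
           (ΣL-*ˡ (upTo (suc i)) (δ (n ∸ a) p) (λ b → δ (i ∸ b) q * (if r ≤ᵇ j then F a b (j ∸ r) else + 0)))) ⟩
    Σ≤ n (λ a → δ (n ∸ a) p * Σ≤ i (λ b → δ (i ∸ b) q * (if r ≤ᵇ j then F a b (j ∸ r) else + 0)))
      ≡⟨ ΣL-cong (upTo (suc n)) (λ a → cong (δ (n ∸ a) p *_) (Σ≤-pick i q (λ b → if r ≤ᵇ j then F a b (j ∸ r) else + 0))) ⟩
    Σ≤ n (λ a → δ (n ∸ a) p * (if q ≤ᵇ i then (if r ≤ᵇ j then F a (i ∸ q) (j ∸ r) else + 0) else + 0))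
      ≡⟨ Σ≤-pick n p (λ a → if q ≤ᵇ i then (if r ≤ᵇ j then F a (i ∸ q) (j ∸ r) else + 0) else + 0) ⟩
    shiftXYA p q r F n i j ∎
    where
    open ≡-Reasoning
    rearrange : ∀ f x y z → f * (x * (y * z)) ≡ x * (y * (z * f))
    rearrange = solve-∀
    pick-c : ∀ a b → Σ≤ j (λ c → δ (n ∸ a) p * (δ (i ∸ b) q * (δ (j ∸ c) r * F a b c)))
                   ≡ δ (n ∸ a) p * (δ (i ∸ b) q * (if r ≤ᵇ j then F a b (j ∸ r) else + 0))
    pick-c a b = begin
      Σ≤ j (λ c → δ (n ∸ a) p * (δ (i ∸ b) q * (δ (j ∸ c) r * F a b c)))
        ≡⟨ ΣL-*ˡ (upTo (suc j)) (δ (n ∸ a) p) (λ c → δ (i ∸ b) q * (δ (j ∸ c) r * F a b c)) ⟩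
      δ (n ∸ a) p * Σ≤ j (λ c → δ (i ∸ b) q * (δ (j ∸ c) r * F a b c))
        ≡⟨ cong (δ (n ∸ a) p *_) (ΣL-*ˡ (upTo (suc j)) (δ (i ∸ b) q) (λ c → δ (j ∸ c) r * F a b c)) ⟩
      δ (n ∸ a) p * (δ (i ∸ b) q * Σ≤ j (λ c → δ (j ∸ c) r * F a b c))
        ≡⟨ cong (λ s → δ (n ∸ a) p * (δ (i ∸ b) q * s)) (Σ≤-pick j r (F a b)) ⟩
      δ (n ∸ a) p * (δ (i ∸ b) q * (if r ≤ᵇ j then F a b (j ∸ r) else + 0)) ∎

  Den≗ : ∀ x y z →
    Den x y z ≡ (monomial 0 0 0 ⊕ - + 1 · monomial 2 1 0 ⊕ - + 2 · monomial 2 2 1 ⊕ - + 1 · monomial 2 1 2) x y z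
  Den≗ 0 0 0 = refl
  Den≗ 0 0 (suc _) = refl
  Den≗ 0 (suc _) _ = refl
  Den≗ 1 _ _ = refl
  Den≗ 2 0 _ = refl
  Den≗ 2 1 0 = refl
  Den≗ 2 1 1 = refl
  Den≗ 2 1 2 = refl
  Den≗ 2 1 (suc (suc (suc _))) = refl
  Den≗ 2 2 0 = refl
  Den≗ 2 2 1 = refl
  Den≗ 2 2 (suc (suc _)) = refl
  Den≗ 2 (suc (suc (suc _))) _ = refl
  Den≗ (suc (suc (suc _))) _ _ = refl

  ⋆-Den : ∀ F n i j → (F ⋆ Den) n i j ≡
    shiftXYA 0 0 0 F n i j - shiftXYA 2 1 0 F n i j - + 2 * shiftXYA 2 2 1 F n i j - shiftXYA 2 1 2 F n i j
  ⋆-Den F n i j = begin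
    (F ⋆ Den) n i j
      ≡⟨ ⋆-congʳ F Den≗ n i j ⟩
    (F ⋆ (m₀ ⊕ k₁ · m₁ ⊕ k₂ · m₂ ⊕ k₁ · m₃)) n i j
      ≡⟨ ⋆-⊕ʳ F (m₀ ⊕ k₁ · m₁ ⊕ k₂ · m₂) (k₁ · m₃) n i j ⟩
    (F ⋆ (m₀ ⊕ k₁ · m₁ ⊕ k₂ · m₂)) n i j + (F ⋆ (k₁ · m₃)) n i j
      ≡⟨ cong₂ _+_ (⋆-⊕ʳ F (m₀ ⊕ k₁ · m₁) (k₂ · m₂) n i j) (⋆-·ʳ F k₁ m₃ n i j) ⟩
    (F ⋆ (m₀ ⊕ k₁ · m₁)) n i j + (F ⋆ (k₂ · m₂)) n i j + k₁ * (F ⋆ m₃) n i j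
      ≡⟨ cong (λ s → s + k₁ * (F ⋆ m₃) n i j) (cong₂ _+_ (⋆-⊕ʳ F m₀ (k₁ · m₁) n i j) (⋆-·ʳ F k₂ m₂ n i j)) ⟩
    (F ⋆ m₀) n i j + (F ⋆ (k₁ · m₁)) n i j + k₂ * (F ⋆ m₂) n i j + k₁ * (F ⋆ m₃) n i j
      ≡⟨ cong (λ s → (F ⋆ m₀) n i j + s + k₂ * (F ⋆ m₂) n i j + k₁ * (F ⋆ m₃) n i j) (⋆-·ʳ F k₁ m₁ n i j) ⟩
    (F ⋆ m₀) n i j + k₁ * (F ⋆ m₁) n i j + k₂ * (F ⋆ m₂) n i j + k₁ * (F ⋆ m₃) n i j
      ≡⟨ cong₂ (λ s t → s + k₁ * t) (cong₂ (λ s t → s + k₂ * t) (cong₂ (λ s t → s + k₁ * t)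
           (⋆-monomial F 0 0 0 n i j) (⋆-monomial F 2 1 0 n i j)) (⋆-monomial F 2 2 1 n i j)) (⋆-monomial F 2 1 2 n i j) ⟩
    S₀ + k₁ * S₁ + k₂ * S₂ + k₁ * S₃
      ≡⟨ as-differences S₀ S₁ S₂ S₃ ⟩
    S₀ - S₁ - + 2 * S₂ - S₃ ∎
    where
    open ≡-Reasoning
    m₀ = monomial 0 0 0
    m₁ = monomial 2 1 0
    m₂ = monomial 2 2 1
    m₃ = monomial 2 1 2
    k₁ = - + 1
    k₂ = - + 2
    S₀ = shiftXYA 0 0 0 F n i j
    S₁ = shiftXYA 2 1 0 F n i j
    S₂ = shiftXYA 2 2 1 F n i j
    S₃ = shiftXYA 2 1 2 F n i j
    as-differences : ∀ a b c d → a + - + 1 * b + - + 2 * c + - + 1 * d ≡ a - b - + 2 * c - d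
    as-differences = solve-∀

  shiftXYA-M : ∀ m q r i j → shiftXYA 2 q r M (suc (suc (suc m))) i j ≡ + shiftYA q r (Count (suc m)) i j
  shiftXYA-M m q r i j with q ≤ᵇ i | r ≤ᵇ j
  ... | true  | true  = refl
  ... | true  | false = refl
  ... | false | _     = refl

  coefficients : ∀ n i j →
    shiftXYA 0 0 0 M n i j - shiftXYA 2 1 0 M n i j - + 2 * shiftXYA 2 2 1 M n i j - shiftXYA 2 1 2 M n i j ≡ Num n i j
  coefficients 0 i j = refl
  coefficients 1 0 0 = refl
  coefficients 1 0 (suc j) = refl
  coefficients 1 (suc i) 0 = refl
  coefficients 1 (suc i) (suc j) = refl
  coefficients 2 0 0 = refl
  coefficients 2 0 1 = refl
  coefficients 2 0 (suc (suc _)) = refl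
  coefficients 2 1 0 = refl
  coefficients 2 1 1 = refl
  coefficients 2 1 (suc (suc _)) = refl
  coefficients 2 (suc (suc _)) 0 = refl
  coefficients 2 (suc (suc _)) 1 = refl
  coefficients 2 (suc (suc _)) (suc (suc _)) = refl
  coefficients (suc (suc (suc m))) i j = begin
    + Count n i j - S₁ - + 2 * S₂ - S₃
      ≡⟨ cong₂ (λ s t → + Count n i j - s - + 2 * t - S₃) (shiftXYA-M m 1 0 i j) (shiftXYA-M m 2 1 i j) ⟩
    + Count n i j - + a - + 2 * + b - S₃
      ≡⟨ cong₂ (λ s t → + s - + a - + 2 * + b - t) (Count-recurrence m i j) (shiftXYA-M m 1 2 i j) ⟩
    + (a ℕ.+ b ℕ.+ (b ℕ.+ d)) - + a - + 2 * + b - + d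
      ≡⟨ cong (λ s → s - + a - + 2 * + b - + d) (trans (pos-+ (a ℕ.+ b) (b ℕ.+ d)) (cong₂ _+_ (pos-+ a b) (pos-+ b d))) ⟩
    + a + + b + (+ b + + d) - + a - + 2 * + b - + d
      ≡⟨ cancel (+ a) (+ b) (+ d) ⟩
    + 0 ∎
    where
    open ≡-Reasoning
    n = suc (suc (suc m))
    C = Count (suc m)
    a = shiftYA 1 0 C i j
    b = shiftYA 2 1 C i j
    d = shiftYA 1 2 C i j
    S₁ = shiftXYA 2 1 0 M n i j
    S₂ = shiftXYA 2 2 1 M n i j
    S₃ = shiftXYA 2 1 2 M n i j
    cancel : ∀ a b d → a + b + (b + d) - a - + 2 * b - d ≡ + 0
    cancel = solve-∀

open PowerSeries using (⋆-Den; coefficients)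

theorem6p1 : ∀ (n i j : ℕ) → (M ⋆ Den) n i j ≡ Num n i j
theorem6p1 n i j = trans (⋆-Den M n i j) (coefficients n i j)
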